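{- The Boolean function family $\mathrm{3SATC}=(\mathrm{3SATC}_n)_{n\in\mathbb N}$ is $\mathbf{NP}_{\mathrm{IS}}$-complete.
   Context: Let $\mathbb B=\{\mathsf T,\mathsf F\}$. There are Boolean registers named $\mathtt{in}{:}i$, $\mathtt{aux}{:}i$ ($i\ge1$) and $\mathtt{out}$, processing methods $\mathtt{set{:}T}$ (content becomes $\mathsf T$, reply $\mathsf T$), $\mathtt{set{:}F}$ (content becomes $\mathsf F$, reply $\mathsf F$), $\mathtt{get}$ (no change, reply is the content). Basic instructions are $f.m$. Primitive instructions: for each basic instruction $a$, the plain instruction $a$, positive test $+a$, negative test $-a$; forward jumps $\#l$ ($l\in\mathbb N$); termination $!$. An instruction sequence is a finite non-empty sequence $X=u_1;\dots;u_k$ of primitive instructions, $|X|=k$. Execution starts at $u_1$: $a$ executes $a$ and proceeds with the next instruction; $+a$ executes $a$ and proceeds with the next instruction if the reply is $\mathsf T$, otherwise skips the next instruction and proceeds with the one after; $-a$ likewise with reply roles reversed; $\#l$ proceeds with the $l$-th next instruction ($\#0$ causes inaction); $!$ terminates; if there is no instruction to proceed with, inaction occurs. $\mathcal{IS}_{br}$ is the set of instruction sequences whose basic instructions are all of the forms $\mathtt{in}{:}i.\mathtt{get}$, $\mathtt{aux}{:}i.\mathtt{get}$, $\mathtt{aux}{:}i.\mathtt{set{:}}b$, $\mathtt{out}.\mathtt{set{:}}b$. $X$ computes $f:\mathbb B^n\to\mathbb B$ if for all $b_1,\dots,b_n$, executing $X$ with $\mathtt{in}{:}i$ initially $b_i$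 ($i\le n$) and all auxiliary registers and $\mathtt{out}$ initially $\mathsf F$, execution never executes an instruction on $\mathtt{in}{:}i$ with $i>n$, ends by executing $!$, and leaves $f(b_1,\dots,b_n)$ in $\mathtt{out}$. A Boolean function family is a sequence $(f_n)_{n\in\mathbb N}$ with $f_n:\mathbb B^n\to\mathbb B$. $\mathbf P_{\mathrm{IS}}$ is the class of families $(g_n)$ for which there is a polynomial $h$ such that for every $n$ some $X\in\mathcal{IS}_{br}$ computes $g_n$ with $|X|\le h(n)$. $\mathbf{NP}_{\mathrm{IS}}$ is the class of families $(f_n)$ for which there exist a monotonic polynomial $h$ and $(g_n)\in\mathbf P_{\mathrm{IS}}$ with $f_n(w)=\mathsf T\iff\exists c\in\mathbb B^{h(n)}\,g_{n+h(n)}(wc)=\mathsf T$ for all $n$, $w\in\mathbb B^n$. Reducibility: for $l,m,n\in\mathbb N$, $f:\mathbb B^n\to\mathbb B$ and $g:\mathbb B^m\to\mathbb B$, $f\le_l g$ if there exist $h_1,\dots,h_m:\mathbb B^n\to\mathbb B$ computed by $X_1,\dots,X_m\in\mathcal{IS}_{br}$ with $|X_j|\le l$ such that $f(b)=g(h_1(b),\dots,h_m(b))$ for all $b\in\mathbb B^n$. A family $(f_n)$ is non-uniform polynomial-length reducible to $(g_n)$ if there is a polynomial $h$ such that for every $n$ there exist $l,m\le h(n)$ with $f_n\le_l g_m$. $(f_n)$ is $\mathbf{NP}_{\mathrm{IS}}$-complete if $(f_n)\in\mathbf{NP}_{\mathrm{IS}}$ and every family in $\mathbf{NP}_{\mathrm{IS}}$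 is non-uniform polynomial-length reducible to $(f_n)$. The family $\mathrm{3SATC}$: let $\mathrm{nd}(k)=\binom{2k}{1}+\binom{2k}{2}+\binom{2k}{3}$; fix bijections $\alpha_k:[1,\mathrm{nd}(k)]\to\{L\subseteq\{v_1,\neg v_1,\dots,v_k,\neg v_k\}\mid1\le|L|\le3\}$ with $\alpha_i^{ -1}(\alpha_{i+1}(j))=j$ for all $i$ and $j\in[1,\mathrm{nd}(i)]$, such that $\alpha(i)=\alpha_{\min\{j\mid i\in[1,\mathrm{nd}(j)]\}}(i)$ is polynomial-time computable; if $n=\mathrm{nd}(k)$ then $\mathrm{3SATC}_n(b_1,\dots,b_n)=\mathsf T$ iff $\bigwedge_{i\in[1,n],\,b_i=\mathsf T}\bigvee\alpha_k(i)$ is satisfiable; if $\mathrm{nd}(k)<n<\mathrm{nd}(k+1)$ then $\mathrm{3SATC}_n(b_1,\dots,b_n)=\mathrm{3SATC}_{\mathrm{nd}(k)}(b_1,\dots,b_{\mathrm{nd}(k)})$. -}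

module Defs where

open import Data.Bool using (Bool; true; false; if_then_else_)
open import Data.Nat using (ℕ; zero; suc; _+_; _*_; _≤_; _<_; _<?_)
open import Data.Nat.Combinatorics using (_C_)
open import Data.Fin using (Fin; toℕ; fromℕ<; inject≤)
open import Data.Fin.Subset using (Subset; ∣_∣)
open import Data.Vec using (Vec; lookup; tabulate; _++_; _∷ʳ_)
open import Data.List using (List; []; _∷_; foldr)
open import Data.List.NonEmpty using (List⁺; toList) renaming (length to length⁺)
open import Data.Maybe using (Maybe; just; nothing)
open import Data.Product using (Σ; ∃; ∃-syntax; _×_; _,_)
open import Data.Sum using (_⊎_)
open import Relation.Binary.PropositionalEquality using (_≡_)
open import Relation.Nullary using (yes; no)
open import Function.Bundles using (_⇔_)

-- Basic instructions allowed in IS_br.  Register indices are shifted: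
-- the index k : ℕ denotes register number k+1 (registers are in:i, aux:i, i ≥ 1).
data Basic : Set where
  inGet  : ℕ → Basic
  auxGet : ℕ → Basic
  auxSet : ℕ → Bool → Basic
  outSet : Bool → Basic

data Instr : Set where
  plain : Basic → Instr
  ptest : Basic → Instr
  ntest : Basic → Instr
  jump  : ℕ → Instr
  halt  : Instr

InstrSeq : Set
InstrSeq = List⁺ Instr

len : InstrSeq → ℕ
len = length⁺

record State : Set where
  constructor st
  field
    aux : ℕ → Bool
    out : Bool
open State

initState : State
initState = st (λ _ → false) false

update : (ℕ → Bool) → ℕ → Bool → (ℕ → Bool)
update f k b j with j Data.Nat.≟ k
... | yes _ = b
... | no  _ = f j

stepBasic : ∀ {n} → Vec Bool n → Basic → State → Maybe (Bool × State)
stepBasic {n} bs (inGet k) s with k <? n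
... | yes p = just (lookup bs (fromℕ< p) , s)
... | no  _ = nothing
stepBasic bs (auxGet k) s = just (aux s k , s)
stepBasic bs (auxSet k b) s = just (b , st (update (aux s) k b) (out s))
stepBasic bs (outSet b) s = just (b , st (aux s) b)

data Outcome : Set where
  terminated : Bool → Outcome
  inaction   : Outcome
  illegal    : Outcome

-- exec bs us k s : execution proceeding with the (k+1)-th instruction of us.
exec : ∀ {n} → Vec Bool n → List Instr → ℕ → State → Outcome
exec bs [] k s = inaction
exec bs (u ∷ us) (suc k) s = exec bs us k s
exec bs (plain a ∷ us) zero s with stepBasic bs a s
... | nothing = illegal
... | just (r , s') = exec bs us zero s'
exec bs (ptest a ∷ us) zero s with stepBasic bs a s
... | nothing = illegal
... | just (r , s') = exec bs us (if r then 0 else 1) s'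
exec bs (ntest a ∷ us) zero s with stepBasic bs a s
... | nothing = illegal
... | just (r , s') = exec bs us (if r then 1 else 0) s'
exec bs (jump zero ∷ us) zero s = inaction
exec bs (jump (suc l) ∷ us) zero s = exec bs us l s
exec bs (halt ∷ us) zero s = terminated (out s)

run : ∀ {n} → InstrSeq → Vec Bool n → Outcome
run X bs = exec bs (toList X) zero initState

BoolFun : ℕ → Set
BoolFun n = Vec Bool n → Bool

BoolFamily : Set
BoolFamily = (n : ℕ) → BoolFun n

Computes : ∀ {n} → InstrSeq → BoolFun n → Set
Computes X f = ∀ bs → run X bs ≡ terminated (f bs)

-- Polynomials (natural-number coefficients, lowest degree first)

Poly : Set
Poly = List ℕ

⟦_⟧ : Poly → ℕ → ℕ
⟦ p ⟧ x = foldr (λ c acc → c + x * acc) 0 p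

Monotonic : (ℕ → ℕ) → Set
Monotonic h = ∀ m n → m ≤ n → h m ≤ h n

P-IS : BoolFamily → Set
P-IS g = ∃[ h ] ∀ n → ∃[ X ] (len X ≤ ⟦ h ⟧ n × Computes X (g n))

NP-IS : BoolFamily → Set
NP-IS f = ∃[ h ] Monotonic ⟦ h ⟧ × ∃[ g ] (P-IS g ×
  (∀ n (w : Vec Bool n) →
     (f n w ≡ true) ⇔ (Σ (Vec Bool (⟦ h ⟧ n)) λ c → (g (n + ⟦ h ⟧ n) (w ++ c) ≡ true))))

Reduces : ∀ {n m} → ℕ → BoolFun n → BoolFun m → Set
Reduces {n} {m} l f g =
  Σ (Fin m → BoolFun n) λ hs → ((∀ (j : Fin m) → ∃[ X ] (len X ≤ l × Computes X (hs j))) ×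
           (∀ (b : Vec Bool n) → f b ≡ g (tabulate (λ j → hs j b))))

PolyReducible : BoolFamily → BoolFamily → Set
PolyReducible f g = ∃[ h ] ∀ n → ∃[ l ] ∃[ m ]
  (l ≤ ⟦ h ⟧ n × m ≤ ⟦ h ⟧ n × Reduces l (f n) (g m))

NP-IS-complete : BoolFamily → Set
NP-IS-complete f = NP-IS f × (∀ g → NP-IS g → PolyReducible g f)

nd : ℕ → ℕ
nd k = (2 * k) C 1 + (2 * k) C 2 + (2 * k) C 3

-- A set of literals over v_1..v_k, given as (P , N): v_i ∈ L iff i ∈ P,
-- ¬v_i ∈ L iff i ∈ N.
LitSet : ℕ → Set
LitSet k = Subset k × Subset k

size : ∀ {k} → LitSet k → ℕ
size (P , N) = ∣ P ∣ + ∣ N ∣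

embed : ∀ {k} → LitSet k → LitSet (suc k)
embed (P , N) = (P ∷ʳ false , N ∷ʳ false)

-- α k j is α_k (j+1); the conditions: α_k is a bijection from [1, nd k]
-- onto the literal sets of size 1..3, and α_(i+1)(j) = α_i(j) for j ≤ nd i.
ValidEnumeration : ((k : ℕ) → Fin (nd k) → LitSet k) → Set
ValidEnumeration α =
  (∀ k (i j : Fin (nd k)) → α k i ≡ α k j → i ≡ j) ×
  (∀ k (j : Fin (nd k)) → 1 ≤ size (α k j) × size (α k j) ≤ 3) ×
  (∀ k (L : LitSet k) → 1 ≤ size L → size L ≤ 3 → ∃[ j ] α k j ≡ L) ×
  (∀ i (j : Fin (nd i)) (j' : Fin (nd (suc i))) → toℕ j ≡ toℕ j' →
     α (suc i) j' ≡ embed (α i j))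

SatClause : ∀ {k} → Vec Bool k → LitSet k → Set
SatClause a (P , N) = ∃[ x ]
  ((lookup P x ≡ true × lookup a x ≡ true) ⊎ (lookup N x ≡ true × lookup a x ≡ false))

Satisfiable : (α : (k : ℕ) → Fin (nd k) → LitSet k) → (k : ℕ) → (Fin (nd k) → Bool) → Set
Satisfiable α k sel = ∃[ a ] (∀ i → sel i ≡ true → SatClause a (α k i))

Is3SATC : ((k : ℕ) → Fin (nd k) → LitSet k) → BoolFamily → Set
Is3SATC α F = ∀ k n (p : nd k ≤ n) → n < nd (suc k) → (b : Vec Bool n) →
  (F n b ≡ true) ⇔ Satisfiable α k (λ i → lookup b (inject≤ i p))

-- Membership: a certificate for 3SATC_n(w) is an assignment to v_1 … v_k, where nd k ≤ n < nd (k+1),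
-- stored in the inputs n, …, n+k-1; an instruction sequence of quadratic length tests, clause by
-- clause, that every clause selected by w has a true literal.
-- Hardness: let g be the polynomial-length verifier of f ∈ NP_IS, computed by X. The run of X on the
-- inputs is described by a 3-CNF whose variables are the inputs and, for each position i of X, "i is
-- reached", "content of out on arrival at i", "the reply at i is T / F" and, for each position j,
-- "content on arrival at i of the auxiliary register used at j". Since jumps only go forward, every
-- satisfying assignment agrees with the actual run on the positions it reaches, so out is T when !
-- is executed; conversely an accepting run yields a satisfying assignment. The reduction selects the
-- clauses of this 3-CNF together with the unit clauses fixing the first n inputs to w; each selector is
-- a constant or a literal of w, computed by at most three instructions, and nd of the number of
-- variables is polynomial in n.

module Submission where

open import Defs
open import Data.Bool using (Bool; true; false; not; if_then_else_; _∧_; _∨_)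
import Data.Bool as Bool
open import Data.Empty using (⊥)
open import Data.Fin using (Fin; toℕ; fromℕ<; inject≤; zero; suc)
open import Data.Fin.Properties using (toℕ<n; toℕ-fromℕ<; toℕ-inject≤; inject≤-refl)
import Data.Fin.Properties as Fin
open import Data.Fin.Subset using (Subset; ∣_∣; ⁅_⁆; _∪_) renaming (⊥ to ∅)
open import Data.Fin.Subset.Properties using (∣⁅x⁆∣≡1; ∣⊥∣≡0; ∣p∣≤∣p∪q∣; x∈⁅x⁆; x∈⁅y⁆⇒x≡y; x∈p∪q⁻; x∈p∪q⁺)
open import Data.List using (List; []; _∷_; _++_; map; concat; applyUpTo; drop; length; head)
import Data.List as List
open import Data.List.NonEmpty using (_∷_; toList)
open import Data.List.Properties using (length-++; length-map; length-tabulate)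
open import Data.List.Relation.Unary.All using (All; []; _∷_)
import Data.List.Relation.Unary.All as All
import Data.List.Relation.Unary.All.Properties as Allₚ
open import Data.List.Relation.Unary.Any using (Any; here; there)
import Data.List.Relation.Unary.Any as Any
import Data.List.Relation.Unary.Any.Properties as Anyₚ
open import Data.Maybe using (Maybe; just; nothing; maybe′; fromMaybe; _>>=_)
import Data.Maybe as Maybe
open import Data.Nat
open import Data.Nat.Properties
open import Algebra.Properties.CommutativeSemigroup *-commutativeSemigroup using (interchange)
open import Algebra.Properties.CommutativeSemigroup +-commutativeSemigroup using (x∙yz≈y∙xz)
open import Data.Nat.Tactic.RingSolver using (solve-∀)
open import Data.Product using (Σ; ∃; ∃-syntax; _×_; _,_; proj₁; proj₂)
import Data.Product.Properties as Product
open import Data.Sum using (_⊎_; inj₁; inj₂)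
open import Data.Unit using (⊤)
open import Data.Vec using (Vec; lookup; tabulate; []; _∷_) renaming (_++_ to _++ᵛ_)
open import Data.Vec.Properties using (lookup⇒[]=; []=⇒lookup; lookup-replicate; lookup∘tabulate)
import Data.Vec.Properties as Vec
open import Function using (_∘_)
open import Function.Bundles using (_⇔_; mk⇔; Equivalence)
open import Function.Properties.Equivalence using (⇔-setoid)
open import Level using (0ℓ)
open import Relation.Binary.PropositionalEquality
open import Relation.Nullary using (Dec; yes; no; ¬_; contradiction)

open State

data Kind : Set where
  plainᵏ ptestᵏ ntestᵏ : Kind

withKind : Kind → Basic → Instr
withKind plainᵏ = plain
withKind ptestᵏ = ptest
withKind ntestᵏ = ntest

skipped : Kind → Bool → ℕ
skipped plainᵏ _ = 0
skipped ptestᵏ r = if r then 0 else 1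
skipped ntestᵏ r = if r then 1 else 0

data InstrView : Instr → Set where
  basic : ∀ κ a → InstrView (withKind κ a)
  jump  : ∀ l → InstrView (jump l)
  halt  : InstrView halt

instrView : ∀ u → InstrView u
instrView (plain a) = basic plainᵏ a
instrView (ptest a) = basic ptestᵏ a
instrView (ntest a) = basic ntestᵏ a
instrView (jump l) = jump l
instrView halt = halt

data Step : Set where
  advance : ℕ → State → Step
  finish  : Outcome → Step

afterBasic : Kind → Maybe (Bool × State) → Step
afterBasic κ nothing = finish illegal
afterBasic κ (just (r , s')) = advance (skipped κ r) s'

step : ∀ {n} → Vec Bool n → Instr → State → Step
step bs (plain a) s = afterBasic plainᵏ (stepBasic bs a s)
step bs (ptest a) s = afterBasic ptestᵏ (stepBasic bs a s)
step bs (ntest a) s = afterBasic ntestᵏ (stepBasic bs a s)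
step bs (jump zero) s = finish inaction
step bs (jump (suc l)) s = advance l s
step bs halt s = finish (terminated (out s))

step-withKind : ∀ {n} (bs : Vec Bool n) κ a s → step bs (withKind κ a) s ≡ afterBasic κ (stepBasic bs a s)
step-withKind bs plainᵏ a s = refl
step-withKind bs ptestᵏ a s = refl
step-withKind bs ntestᵏ a s = refl

resume : ∀ {n} → Vec Bool n → List Instr → Step → Outcome
resume bs us (advance k s) = exec bs us k s
resume bs us (finish o) = o

exec-∷ : ∀ {n} (bs : Vec Bool n) u us s → exec bs (u ∷ us) 0 s ≡ resume bs us (step bs u s)
exec-∷ bs (plain a) us s with stepBasic bs a s
... | nothing = refl
... | just _ = refl
exec-∷ bs (ptest a) us s with stepBasic bs a s
... | nothing = refl
... | just _ = refl
exec-∷ bs (ntest a) us s with stepBasic bs a s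
... | nothing = refl
... | just _ = refl
exec-∷ bs (jump zero) us s = refl
exec-∷ bs (jump (suc l)) us s = refl
exec-∷ bs halt us s = refl

exec-++ : ∀ {n} (bs : Vec Bool n) xs ys s → exec bs (xs ++ ys) (length xs) s ≡ exec bs ys 0 s
exec-++ bs [] ys s = refl
exec-++ bs (x ∷ xs) ys s = exec-++ bs xs ys s

-- Jumps go forward, so a position is reached at most once; stateAt gives the state on arrival.
stateAt : ∀ {n} → Vec Bool n → List Instr → ℕ → State → ℕ → Maybe State
stateAfter : ∀ {n} → Vec Bool n → List Instr → Step → ℕ → Maybe State
stateAt bs [] k s t = nothing
stateAt bs (u ∷ us) (suc k) s zero = nothing
stateAt bs (u ∷ us) (suc k) s (suc t) = stateAt bs us k s t
stateAt bs (u ∷ us) zero s zero = just s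
stateAt bs (u ∷ us) zero s (suc t) = stateAfter bs us (step bs u s) t
stateAfter bs us (advance k s') t = stateAt bs us k s' t
stateAfter bs us (finish o) t = nothing

stateAt-start : ∀ {n} (bs : Vec Bool n) us k s → k < length us → stateAt bs us k s k ≡ just s
stateAt-start bs (u ∷ us) zero s _ = refl
stateAt-start bs (u ∷ us) (suc k) s (s≤s p) = stateAt-start bs us k s p

exec-stateAt : ∀ {n} (bs : Vec Bool n) us k s t s₀ → stateAt bs us k s t ≡ just s₀ →
               exec bs us k s ≡ exec bs (drop t us) 0 s₀
exec-stateAt bs [] k s t s₀ ()
exec-stateAt bs (u ∷ us) (suc k) s zero s₀ ()
exec-stateAt bs (u ∷ us) (suc k) s (suc t) s₀ e = exec-stateAt bs us k s t s₀ e
exec-stateAt bs (u ∷ us) zero s zero s₀ refl = refl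
exec-stateAt bs (u ∷ us) zero s (suc t) s₀ e with step bs u s in eq
... | advance k s' = begin
  exec bs (u ∷ us) 0 s             ≡⟨ exec-∷ bs u us s ⟩
  resume bs us (step bs u s)       ≡⟨ cong (resume bs us) eq ⟩
  exec bs us k s'                  ≡⟨ exec-stateAt bs us k s' t s₀ e ⟩
  exec bs (drop t us) 0 s₀         ∎
  where open ≡-Reasoning

stateAt-+ : ∀ {n} (bs : Vec Bool n) us k s t s₀ d → stateAt bs us k s t ≡ just s₀ →
            stateAt bs us k s (t + d) ≡ stateAt bs (drop t us) 0 s₀ d
stateAt-+ bs [] k s t s₀ d ()
stateAt-+ bs (u ∷ us) (suc k) s zero s₀ d ()
stateAt-+ bs (u ∷ us) (suc k) s (suc t) s₀ d e = stateAt-+ bs us k s t s₀ d e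
stateAt-+ bs (u ∷ us) zero s zero s₀ d refl = refl
stateAt-+ bs (u ∷ us) zero s (suc t) s₀ d e with step bs u s
... | advance k s' = stateAt-+ bs us k s' t s₀ d e

drop-∷ : ∀ {A : Set} (xs : List A) i {u us} → drop i xs ≡ u ∷ us → drop (suc i) xs ≡ us
drop-∷ (x ∷ xs) zero refl = refl
drop-∷ (x ∷ xs) (suc i) d = drop-∷ xs i d

length-drop-∷ : ∀ {A : Set} (xs : List A) i {u us} → drop i xs ≡ u ∷ us → length xs ≡ i + suc (length us)
length-drop-∷ (x ∷ xs) zero refl = refl
length-drop-∷ (x ∷ xs) (suc i) d = cong suc (length-drop-∷ xs i d)

drop-∷⇒< : ∀ {A : Set} (xs : List A) i {u us} → drop i xs ≡ u ∷ us → i < length xs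
drop-∷⇒< xs i {us = us} d = subst (i <_) (sym (length-drop-∷ xs i d)) (m<m+n i z<s)

-- Polynomial bounds

PolyBounded : (ℕ → ℕ) → Set
PolyBounded f = ∃[ c ] ∃[ d ] ∀ x → f x ≤ c * suc x ^ d

polyBounded-≤ : ∀ {f g} → (∀ x → f x ≤ g x) → PolyBounded g → PolyBounded f
polyBounded-≤ f≤g (c , d , bound) = c , d , λ x → ≤-trans (f≤g x) (bound x)

polyBounded-const : ∀ c → PolyBounded (λ _ → c)
polyBounded-const c = c , 0 , λ x → ≤-reflexive (sym (*-identityʳ c))

polyBounded-id : PolyBounded (λ x → x)
polyBounded-id = 1 , 1 , λ x → ≤-trans (n≤1+n x) (≤-reflexive (sym (trans (*-identityˡ _) (*-identityʳ _))))

polyBounded-+ : ∀ {f g} → PolyBounded f → PolyBounded g → PolyBounded (λ x → f x + g x)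
polyBounded-+ (c , d , bf) (c' , d' , bg) = c + c' , d + d' , λ x → begin
  _                                               ≤⟨ +-mono-≤ (bf x) (bg x) ⟩
  c * suc x ^ d + c' * suc x ^ d'                 ≤⟨ +-mono-≤ (*-monoʳ-≤ c (^-monoʳ-≤ (suc x) (m≤m+n d d')))
                                                              (*-monoʳ-≤ c' (^-monoʳ-≤ (suc x) (m≤n+m d' d))) ⟩
  c * suc x ^ (d + d') + c' * suc x ^ (d + d')    ≡⟨ *-distribʳ-+ (suc x ^ (d + d')) c c' ⟨
  (c + c') * suc x ^ (d + d')                     ∎
  where open ≤-Reasoning

polyBounded-* : ∀ {f g} → PolyBounded f → PolyBounded g → PolyBounded (λ x → f x * g x)
polyBounded-* (c , d , bf) (c' , d' , bg) = c * c' , d + d' , λ x → begin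
  _                                         ≤⟨ *-mono-≤ (bf x) (bg x) ⟩
  (c * suc x ^ d) * (c' * suc x ^ d')       ≡⟨ interchange c (suc x ^ d) c' (suc x ^ d') ⟩
  (c * c') * (suc x ^ d * suc x ^ d')       ≡⟨ cong ((c * c') *_) (^-distribˡ-+-* (suc x) d d') ⟨
  (c * c') * suc x ^ (d + d')               ∎
  where open ≤-Reasoning

polyBounded-^ : ∀ {g} d → PolyBounded g → PolyBounded (λ x → suc (g x) ^ d)
polyBounded-^ zero pg = polyBounded-const 1
polyBounded-^ (suc d) pg = polyBounded-* (polyBounded-+ (polyBounded-const 1) pg) (polyBounded-^ d pg)

polyBounded-∘ : ∀ {f g} → PolyBounded f → PolyBounded g → PolyBounded (λ x → f (g x))
polyBounded-∘ {g = g} (c , d , bf) pg =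
  polyBounded-≤ (λ x → bf (g x)) (polyBounded-* (polyBounded-const c) (polyBounded-^ d pg))

polyBounded-⟦⟧ : ∀ p → PolyBounded ⟦ p ⟧
polyBounded-⟦⟧ [] = polyBounded-const 0
polyBounded-⟦⟧ (a ∷ p) = polyBounded-+ (polyBounded-const a) (polyBounded-* polyBounded-id (polyBounded-⟦⟧ p))

_+ᵖ_ : Poly → Poly → Poly
[] +ᵖ q = q
(a ∷ p) +ᵖ [] = a ∷ p
(a ∷ p) +ᵖ (b ∷ q) = (a + b) ∷ (p +ᵖ q)

⟦+ᵖ⟧ : ∀ p q x → ⟦ p +ᵖ q ⟧ x ≡ ⟦ p ⟧ x + ⟦ q ⟧ x
⟦+ᵖ⟧ [] q x = refl
⟦+ᵖ⟧ (a ∷ p) [] x = sym (+-identityʳ _)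
⟦+ᵖ⟧ (a ∷ p) (b ∷ q) x = begin
  (a + b) + x * ⟦ p +ᵖ q ⟧ x              ≡⟨ cong (λ z → (a + b) + x * z) (⟦+ᵖ⟧ p q x) ⟩
  (a + b) + x * (⟦ p ⟧ x + ⟦ q ⟧ x)      ≡⟨ rearrange a b x (⟦ p ⟧ x) (⟦ q ⟧ x) ⟩
  (a + x * ⟦ p ⟧ x) + (b + x * ⟦ q ⟧ x)  ∎
  where
  open ≡-Reasoning
  rearrange : ∀ a b x u v → (a + b) + x * (u + v) ≡ (a + x * u) + (b + x * v)
  rearrange = solve-∀

_·ᵖ_ : ℕ → Poly → Poly
c ·ᵖ p = map (c *_) p

⟦·ᵖ⟧ : ∀ c p x → ⟦ c ·ᵖ p ⟧ x ≡ c * ⟦ p ⟧ x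
⟦·ᵖ⟧ c [] x = sym (*-zeroʳ c)
⟦·ᵖ⟧ c (a ∷ p) x = begin
  c * a + x * ⟦ c ·ᵖ p ⟧ x   ≡⟨ cong (λ z → c * a + x * z) (⟦·ᵖ⟧ c p x) ⟩
  c * a + x * (c * ⟦ p ⟧ x)     ≡⟨ rearrange c a x (⟦ p ⟧ x) ⟩
  c * (a + x * ⟦ p ⟧ x)         ∎
  where
  open ≡-Reasoning
  rearrange : ∀ c a x u → c * a + x * (c * u) ≡ c * (a + x * u)
  rearrange = solve-∀

[1+x]^ : ℕ → Poly
[1+x]^ zero = 1 ∷ []
[1+x]^ (suc d) = [1+x]^ d +ᵖ (0 ∷ [1+x]^ d)

⟦[1+x]^⟧ : ∀ d x → ⟦ [1+x]^ d ⟧ x ≡ suc x ^ d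
⟦[1+x]^⟧ zero x = cong suc (*-zeroʳ x)
⟦[1+x]^⟧ (suc d) x = begin
  ⟦ [1+x]^ d +ᵖ (0 ∷ [1+x]^ d) ⟧ x          ≡⟨ ⟦+ᵖ⟧ ([1+x]^ d) (0 ∷ [1+x]^ d) x ⟩
  ⟦ [1+x]^ d ⟧ x + x * ⟦ [1+x]^ d ⟧ x      ≡⟨ cong (λ z → z + x * z) (⟦[1+x]^⟧ d x) ⟩
  suc x ^ d + x * suc x ^ d            ∎
  where open ≡-Reasoning

polyBounded⇒poly : ∀ {f} → PolyBounded f → ∃[ q ] ∀ x → f x ≤ ⟦ q ⟧ x
polyBounded⇒poly (c , d , bound) = c ·ᵖ [1+x]^ d , λ x →
  ≤-trans (bound x) (≤-reflexive (sym (trans (⟦·ᵖ⟧ c ([1+x]^ d) x) (cong (c *_) (⟦[1+x]^⟧ d x)))))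

⟦⟧-monotonic : ∀ p → Monotonic ⟦ p ⟧
⟦⟧-monotonic [] m n m≤n = z≤n
⟦⟧-monotonic (a ∷ p) m n m≤n = +-monoʳ-≤ a (*-mono-≤ m≤n (⟦⟧-monotonic p m n m≤n))

module _ where
  open import Data.Nat.Combinatorics using (_C_; nC1≡n; nCk+nC[k+1]≡[n+1]C[k+1])

  C-mono : ∀ n k → n C k ≤ suc n C k
  C-mono n zero = ≤-refl
  C-mono n (suc k) = ≤-trans (m≤n+m (n C suc k) (n C k)) (≤-reflexive (nCk+nC[k+1]≡[n+1]C[k+1] n k))

  C≤^ : ∀ n k → n C k ≤ n ^ k
  C≤^ n zero = ≤-refl
  C≤^ zero (suc k) = z≤n
  C≤^ (suc n) (suc k) = begin
    suc n C suc k                ≡⟨ nCk+nC[k+1]≡[n+1]C[k+1] n k ⟨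
    n C k + n C suc k            ≤⟨ +-mono-≤ (C≤^ n k) (C≤^ n (suc k)) ⟩
    n ^ k + n * n ^ k            ≤⟨ +-mono-≤ (^-monoˡ-≤ k (n≤1+n n)) (*-monoʳ-≤ n (^-monoˡ-≤ k (n≤1+n n))) ⟩
    suc n ^ k + n * suc n ^ k    ∎
    where open ≤-Reasoning

  nd-< : ∀ k → nd k < nd (suc k)
  nd-< k = +-mono-<-≤ (+-mono-<-≤ C1-< (C-grows 2)) (C-grows 3)
    where
    2+2k≡2[1+k] : 2 + 2 * k ≡ 2 * suc k
    2+2k≡2[1+k] = sym (*-suc 2 k)
    C1-< : (2 * k) C 1 < (2 * suc k) C 1
    C1-< = subst₂ _<_ (sym (nC1≡n _)) (sym (nC1≡n _))
             (subst (2 * k <_) 2+2k≡2[1+k] (<-trans (n<1+n _) (n<1+n _)))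
    C-grows : ∀ j → (2 * k) C j ≤ (2 * suc k) C j
    C-grows j = subst (λ m → (2 * k) C j ≤ m C j) 2+2k≡2[1+k] (≤-trans (C-mono _ j) (C-mono _ j))

  nd≤cubic : ∀ k → nd k ≤ (2 * k + (2 * k) * (2 * k)) + (2 * k) * ((2 * k) * (2 * k))
  nd≤cubic k = +-mono-≤ (+-mono-≤ (≤-reflexive (nC1≡n m)) (≤-trans (C≤^ m 2) (≤-reflexive (cong (m *_) (*-identityʳ m)))))
                        (≤-trans (C≤^ m 3) (≤-reflexive (cong (λ z → m * (m * z)) (*-identityʳ m))))
    where m = 2 * k

nd-mono : ∀ {j k} → j ≤ k → nd j ≤ nd k
nd-mono {k = zero} z≤n = ≤-refl
nd-mono {j} {suc k} j≤1+k with m≤n⇒m<n∨m≡n j≤1+k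
... | inj₁ (s≤s j≤k) = ≤-trans (nd-mono j≤k) (<⇒≤ (nd-< k))
... | inj₂ refl = ≤-refl

k≤nd : ∀ k → k ≤ nd k
k≤nd zero = z≤n
k≤nd (suc k) = ≤-<-trans (k≤nd k) (nd-< k)

n<nd[1+n] : ∀ n → n < nd (suc n)
n<nd[1+n] n = <-≤-trans (n<1+n n) (k≤nd (suc n))

levelBelow : ℕ → ℕ → ℕ
levelBelow n zero = zero
levelBelow n (suc m) with nd (suc m) ≤? n
... | yes _ = suc m
... | no _ = levelBelow n m

levelBelow-spec : ∀ n m → n < nd (suc m) → nd (levelBelow n m) ≤ n × n < nd (suc (levelBelow n m))
levelBelow-spec n zero n<nd1 = z≤n , n<nd1
levelBelow-spec n (suc m) n<nd[2+m] with nd (suc m) ≤? n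
... | yes nd[1+m]≤n = nd[1+m]≤n , n<nd[2+m]
... | no nd[1+m]≰n = levelBelow-spec n m (≰⇒> nd[1+m]≰n)

level : ℕ → ℕ
level n = levelBelow n n

level-spec : ∀ n → nd (level n) ≤ n × n < nd (suc (level n))
level-spec n = levelBelow-spec n n (n<nd[1+n] n)

nd[level]≤ : ∀ n → nd (level n) ≤ n
nd[level]≤ n = proj₁ (level-spec n)

level≤ : ∀ n → level n ≤ n
level≤ n = ≤-trans (k≤nd (level n)) (nd[level]≤ n)

polyBounded-nd : PolyBounded nd
polyBounded-nd = polyBounded-≤ nd≤cubic (polyBounded-+ (polyBounded-+ p2k (polyBounded-* p2k p2k))
                                                        (polyBounded-* p2k (polyBounded-* p2k p2k)))
  where
  p2k : PolyBounded (λ k → 2 * k)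
  p2k = polyBounded-* (polyBounded-const 2) polyBounded-id

-- Indices at or beyond the length read as false.
lookupℕ : ∀ {n} → Vec Bool n → ℕ → Bool
lookupℕ [] i = false
lookupℕ (x ∷ xs) zero = x
lookupℕ (x ∷ xs) (suc i) = lookupℕ xs i

lookupℕ-toℕ : ∀ {n} (xs : Vec Bool n) (i : Fin n) → lookupℕ xs (toℕ i) ≡ lookup xs i
lookupℕ-toℕ (x ∷ xs) zero = refl
lookupℕ-toℕ (x ∷ xs) (suc i) = lookupℕ-toℕ xs i

lookup-fromℕ< : ∀ {n} (xs : Vec Bool n) v (v<n : v < n) → lookup xs (fromℕ< v<n) ≡ lookupℕ xs v
lookup-fromℕ< xs v v<n = trans (sym (lookupℕ-toℕ xs (fromℕ< v<n))) (cong (lookupℕ xs) (toℕ-fromℕ< v<n))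

lookupℕ-tabulate : ∀ {n} (f : ℕ → Bool) v → v < n → lookupℕ (tabulate {n = n} (λ x → f (toℕ x))) v ≡ f v
lookupℕ-tabulate {suc n} f zero _ = refl
lookupℕ-tabulate {suc n} f (suc v) (s≤s v<n) = lookupℕ-tabulate {n} (λ v → f (suc v)) v v<n

lookupℕ-++ˡ : ∀ {m n} (xs : Vec Bool m) (ys : Vec Bool n) j → j < m → lookupℕ (xs ++ᵛ ys) j ≡ lookupℕ xs j
lookupℕ-++ˡ (x ∷ xs) ys zero _ = refl
lookupℕ-++ˡ (x ∷ xs) ys (suc j) (s≤s j<m) = lookupℕ-++ˡ xs ys j j<m

lookupℕ-++ʳ : ∀ {m n} (xs : Vec Bool m) (ys : Vec Bool n) j → lookupℕ (xs ++ᵛ ys) (m + j) ≡ lookupℕ ys j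
lookupℕ-++ʳ [] ys j = refl
lookupℕ-++ʳ (x ∷ xs) ys j = lookupℕ-++ʳ xs ys j

Literal : Set
Literal = ℕ × Bool

Clause : Set
Clause = List Literal

LiteralTrue : (ℕ → Bool) → Literal → Set
LiteralTrue σ (v , b) = σ v ≡ b

ClauseTrue : (ℕ → Bool) → Clause → Set
ClauseTrue σ = Any (LiteralTrue σ)

CNFTrue : (ℕ → Bool) → List Clause → Set
CNFTrue σ = All (ClauseTrue σ)

VarsBelow : ℕ → Clause → Set
VarsBelow K = All (λ l → proj₁ l < K)

ClauseTrue-cong : ∀ {K σ τ} C → VarsBelow K C → (∀ v → v < K → σ v ≡ τ v) → ClauseTrue σ C → ClauseTrue τ C
ClauseTrue-cong (l ∷ C) (l<K ∷ _) σ≡τ (here σl) = here (trans (sym (σ≡τ _ l<K)) σl)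
ClauseTrue-cong (l ∷ C) (_ ∷ C<K) σ≡τ (there σC) = there (ClauseTrue-cong C C<K σ≡τ σC)

lookup-∅ : ∀ {K} (x : Fin K) → lookup (∅ {K}) x ≡ false
lookup-∅ x = lookup-replicate x false

lookup-⁅x⁆∪ : ∀ {K} (x : Fin K) p → lookup (⁅ x ⁆ ∪ p) x ≡ true
lookup-⁅x⁆∪ x p = []=⇒lookup (x∈p∪q⁺ (inj₁ (x∈⁅x⁆ x)))

lookup-∪ʳ : ∀ {K} (x : Fin K) p q → lookup p x ≡ true → lookup (q ∪ p) x ≡ true
lookup-∪ʳ x p q px = []=⇒lookup (x∈p∪q⁺ {p = q} (inj₂ (lookup⇒[]= x p px)))

lookup-⁅y⁆∪⁻ : ∀ {K} (y x : Fin K) p → lookup (⁅ y ⁆ ∪ p) x ≡ true → x ≡ y ⊎ lookup p x ≡ true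
lookup-⁅y⁆∪⁻ y x p e with x∈p∪q⁻ ⁅ y ⁆ p (lookup⇒[]= x _ e)
... | inj₁ x∈⁅y⁆ = inj₁ (x∈⁅y⁆⇒x≡y y x∈⁅y⁆)
... | inj₂ x∈p = inj₂ ([]=⇒lookup x∈p)

insertLit : ∀ {K} → Fin K → Bool → LitSet K → LitSet K
insertLit x true (P , N) = (⁅ x ⁆ ∪ P , N)
insertLit x false (P , N) = (P , ⁅ x ⁆ ∪ N)

-- Literals whose variable is not below K are dropped.
toLitSet : (K : ℕ) → Clause → LitSet K
toLitSet K [] = ∅ , ∅
toLitSet K ((v , b) ∷ C) with v <? K
... | yes v<K = insertLit (fromℕ< v<K) b (toLitSet K C)
... | no _ = toLitSet K C

¬SatClause-∅ : ∀ {K} (a : Vec Bool K) → ¬ SatClause a (∅ , ∅)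
¬SatClause-∅ a (x , inj₁ (x∈∅ , _)) = contradiction (trans (sym x∈∅) (lookup-∅ x)) λ ()
¬SatClause-∅ a (x , inj₂ (x∈∅ , _)) = contradiction (trans (sym x∈∅) (lookup-∅ x)) λ ()

SatClause-insertLit : ∀ {K} (a : Vec Bool K) x b L → SatClause a L → SatClause a (insertLit x b L)
SatClause-insertLit a x true (P , N) (y , inj₁ (y∈P , ay)) = y , inj₁ (lookup-∪ʳ y P ⁅ x ⁆ y∈P , ay)
SatClause-insertLit a x true (P , N) (y , inj₂ y∈N) = y , inj₂ y∈N
SatClause-insertLit a x false (P , N) (y , inj₁ y∈P) = y , inj₁ y∈P
SatClause-insertLit a x false (P , N) (y , inj₂ (y∈N , ay)) = y , inj₂ (lookup-∪ʳ y N ⁅ x ⁆ y∈N , ay)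

SatClause-insertLit-new : ∀ {K} (a : Vec Bool K) x b L → lookup a x ≡ b → SatClause a (insertLit x b L)
SatClause-insertLit-new a x true (P , N) ax = x , inj₁ (lookup-⁅x⁆∪ x P , ax)
SatClause-insertLit-new a x false (P , N) ax = x , inj₂ (lookup-⁅x⁆∪ x N , ax)

SatClause-insertLit⁻ : ∀ {K} (a : Vec Bool K) x b L → SatClause a (insertLit x b L) → lookup a x ≡ b ⊎ SatClause a L
SatClause-insertLit⁻ a x true (P , N) (y , inj₁ (y∈xP , ay)) with lookup-⁅y⁆∪⁻ x y P y∈xP
... | inj₁ refl = inj₁ ay
... | inj₂ y∈P = inj₂ (y , inj₁ (y∈P , ay))
SatClause-insertLit⁻ a x true (P , N) (y , inj₂ y∈N) = inj₂ (y , inj₂ y∈N)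
SatClause-insertLit⁻ a x false (P , N) (y , inj₁ y∈P) = inj₂ (y , inj₁ y∈P)
SatClause-insertLit⁻ a x false (P , N) (y , inj₂ (y∈xN , ay)) with lookup-⁅y⁆∪⁻ x y N y∈xN
... | inj₁ refl = inj₁ ay
... | inj₂ y∈N = inj₂ (y , inj₂ (y∈N , ay))

SatClause-toLitSet⁻ : ∀ {K} (a : Vec Bool K) C → SatClause a (toLitSet K C) → ClauseTrue (lookupℕ a) C
SatClause-toLitSet⁻ a [] sat = contradiction sat (¬SatClause-∅ a)
SatClause-toLitSet⁻ {K} a ((v , b) ∷ C) sat with v <? K
... | no _ = there (SatClause-toLitSet⁻ a C sat)
... | yes v<K with SatClause-insertLit⁻ a (fromℕ< v<K) b (toLitSet K C) sat
...   | inj₁ av = here (trans (sym (lookup-fromℕ< a v v<K)) av)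
...   | inj₂ satC = there (SatClause-toLitSet⁻ a C satC)

SatClause-toLitSet⁺ : ∀ {K} (a : Vec Bool K) C → VarsBelow K C → ClauseTrue (lookupℕ a) C → SatClause a (toLitSet K C)
SatClause-toLitSet⁺ {K} a ((v , b) ∷ C) (v<K ∷ C<K) true-C with v <? K | true-C
... | no v≮K | _ = contradiction v<K v≮K
... | yes v<K' | here av = SatClause-insertLit-new a (fromℕ< v<K') b _ (trans (lookup-fromℕ< a v v<K') av)
... | yes v<K' | there true-C' = SatClause-insertLit a (fromℕ< v<K') b _ (SatClause-toLitSet⁺ a C C<K true-C')

∣p∪q∣≤∣p∣+∣q∣ : ∀ {K} (p q : Subset K) → ∣ p ∪ q ∣ ≤ ∣ p ∣ + ∣ q ∣
∣p∪q∣≤∣p∣+∣q∣ [] [] = z≤n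
∣p∪q∣≤∣p∣+∣q∣ (true ∷ p) (true ∷ q) = s≤s (≤-trans (∣p∪q∣≤∣p∣+∣q∣ p q) (+-monoʳ-≤ ∣ p ∣ (n≤1+n _)))
∣p∪q∣≤∣p∣+∣q∣ (true ∷ p) (false ∷ q) = s≤s (∣p∪q∣≤∣p∣+∣q∣ p q)
∣p∪q∣≤∣p∣+∣q∣ (false ∷ p) (true ∷ q) = ≤-trans (s≤s (∣p∪q∣≤∣p∣+∣q∣ p q)) (≤-reflexive (sym (+-suc _ _)))
∣p∪q∣≤∣p∣+∣q∣ (false ∷ p) (false ∷ q) = ∣p∪q∣≤∣p∣+∣q∣ p q

∣⁅x⁆∪p∣≤1+∣p∣ : ∀ {K} (x : Fin K) p → ∣ ⁅ x ⁆ ∪ p ∣ ≤ suc ∣ p ∣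
∣⁅x⁆∪p∣≤1+∣p∣ x p = ≤-trans (∣p∪q∣≤∣p∣+∣q∣ ⁅ x ⁆ p) (≤-reflexive (cong (_+ ∣ p ∣) (∣⁅x⁆∣≡1 x)))

1≤∣⁅x⁆∪p∣ : ∀ {K} (x : Fin K) p → 1 ≤ ∣ ⁅ x ⁆ ∪ p ∣
1≤∣⁅x⁆∪p∣ x p = ≤-trans (≤-reflexive (sym (∣⁅x⁆∣≡1 x))) (∣p∣≤∣p∪q∣ ⁅ x ⁆ p)

size-insertLit≤ : ∀ {K} x b (L : LitSet K) → size (insertLit x b L) ≤ suc (size L)
size-insertLit≤ x true (P , N) = +-monoˡ-≤ ∣ N ∣ (∣⁅x⁆∪p∣≤1+∣p∣ x P)
size-insertLit≤ x false (P , N) = ≤-trans (+-monoʳ-≤ ∣ P ∣ (∣⁅x⁆∪p∣≤1+∣p∣ x N)) (≤-reflexive (+-suc _ _))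

1≤size-insertLit : ∀ {K} x b (L : LitSet K) → 1 ≤ size (insertLit x b L)
1≤size-insertLit x true (P , N) = ≤-trans (1≤∣⁅x⁆∪p∣ x P) (m≤m+n _ _)
1≤size-insertLit x false (P , N) = ≤-trans (1≤∣⁅x⁆∪p∣ x N) (m≤n+m _ _)

size-toLitSet≤length : ∀ K C → size (toLitSet K C) ≤ length C
size-toLitSet≤length K [] = ≤-reflexive (cong₂ _+_ (∣⊥∣≡0 K) (∣⊥∣≡0 K))
size-toLitSet≤length K ((v , b) ∷ C) with v <? K
... | yes v<K = ≤-trans (size-insertLit≤ (fromℕ< v<K) b (toLitSet K C)) (s≤s (size-toLitSet≤length K C))
... | no _ = ≤-trans (size-toLitSet≤length K C) (n≤1+n _)

1≤size-toLitSet : ∀ K C → VarsBelow K C → 1 ≤ length C → 1 ≤ size (toLitSet K C)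
1≤size-toLitSet K ((v , b) ∷ C) (v<K ∷ _) _ with v <? K
... | yes v<K' = 1≤size-insertLit (fromℕ< v<K') b (toLitSet K C)
... | no v≮K = contradiction v<K v≮K

unitLitSet : ∀ K v b (v<K : v < K) → toLitSet K ((v , b) ∷ []) ≡ insertLit (fromℕ< v<K) b (∅ , ∅)
unitLitSet K v b v<K with v <? K
... | yes _ = refl
... | no v≮K = contradiction v<K v≮K

side : ∀ {K} → Bool → LitSet K → Subset K
side true = proj₁
side false = proj₂

lookup-side-insertLit : ∀ {K} (x : Fin K) b L → lookup (side b (insertLit x b L)) x ≡ true
lookup-side-insertLit x true (P , N) = lookup-⁅x⁆∪ x P
lookup-side-insertLit x false (P , N) = lookup-⁅x⁆∪ x N

lookup-⁅y⁆∪∅⁻ : ∀ {K} (y x : Fin K) → lookup (⁅ y ⁆ ∪ ∅) x ≡ true → x ≡ y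
lookup-⁅y⁆∪∅⁻ y x e with lookup-⁅y⁆∪⁻ y x ∅ e
... | inj₁ x≡y = x≡y
... | inj₂ x∈∅ = contradiction (trans (sym x∈∅) (lookup-∅ x)) λ ()

lookup-side-insertLit-∅ : ∀ {K} (x y : Fin K) b c → lookup (side c (insertLit y b (∅ , ∅))) x ≡ true → x ≡ y × c ≡ b
lookup-side-insertLit-∅ x y true true x∈ = lookup-⁅y⁆∪∅⁻ y x x∈ , refl
lookup-side-insertLit-∅ x y false false x∈ = lookup-⁅y⁆∪∅⁻ y x x∈ , refl
lookup-side-insertLit-∅ x y true false x∈ = contradiction (trans (sym x∈) (lookup-∅ x)) λ ()
lookup-side-insertLit-∅ x y false true x∈ = contradiction (trans (sym x∈) (lookup-∅ x)) λ ()

insertLit-∅-injective : ∀ {K} (x y : Fin K) b c → insertLit x b (∅ , ∅) ≡ insertLit y c (∅ , ∅) → x ≡ y × b ≡ c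
insertLit-∅-injective x y b c e =
  lookup-side-insertLit-∅ x y c b (subst (λ L → lookup (side b L) x ≡ true) e (lookup-side-insertLit x b (∅ , ∅)))

unitLitSet-injective : ∀ K v b w c → v < K → w < K → toLitSet K ((v , b) ∷ []) ≡ toLitSet K ((w , c) ∷ []) → v ≡ w × b ≡ c
unitLitSet-injective K v b w c v<K w<K e
  with insertLit-∅-injective _ _ b c (trans (sym (unitLitSet K v b v<K)) (trans e (unitLitSet K w c w<K)))
... | x≡y , b≡c = trans (sym (toℕ-fromℕ< v<K)) (trans (cong toℕ x≡y) (toℕ-fromℕ< w<K)) , b≡c

-- Row-major layout: entry (i , j) sits at index j + i * c.
grid : (ℕ → ℕ → Bool) → (m c : ℕ) → Vec Bool (m * c)
grid f zero c = []
grid f (suc m) c = tabulate (λ j → f 0 (toℕ j)) ++ᵛ grid (λ i → f (suc i)) m c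

lookupℕ-grid : ∀ f m c i j → i < m → j < c → lookupℕ (grid f m c) (j + i * c) ≡ f i j
lookupℕ-grid f (suc m) c zero j _ j<c rewrite +-identityʳ j =
  trans (lookupℕ-++ˡ (tabulate (λ j → f 0 (toℕ j))) _ j j<c) (lookupℕ-tabulate (f 0) j j<c)
lookupℕ-grid f (suc m) c (suc i) j (s≤s i<m) j<c = begin
  lookupℕ (grid f (suc m) c) (j + (c + i * c))          ≡⟨ cong (lookupℕ (grid f (suc m) c)) (x∙yz≈y∙xz j c (i * c)) ⟩
  lookupℕ (grid f (suc m) c) (c + (j + i * c))          ≡⟨ lookupℕ-++ʳ {c} (tabulate (λ j → f 0 (toℕ j))) (grid (λ i → f (suc i)) m c) (j + i * c) ⟩
  lookupℕ (grid (λ i → f (suc i)) m c) (j + i * c)      ≡⟨ lookupℕ-grid (λ i → f (suc i)) m c i j i<m j<c ⟩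
  f (suc i) j                                           ∎
  where open ≡-Reasoning

grid-index< : ∀ {i j m c} → i < m → j < c → j + i * c < m * c
grid-index< {i} {j} {m} {c} i<m j<c = ≤-trans (+-monoˡ-< (i * c) j<c) (*-monoˡ-≤ c i<m)

agrees-++ : ∀ {n m} (w : Vec Bool n) (σ : ℕ → Bool) → (∀ q → q < n → σ q ≡ lookupℕ w q) →
            ∀ q → q < n + m → σ q ≡ lookupℕ (w ++ᵛ tabulate {n = m} (λ y → σ (n + toℕ y))) q
agrees-++ [] σ _ q q<m = sym (lookupℕ-tabulate σ q q<m)
agrees-++ (x ∷ w) σ σ≡w zero _ = σ≡w 0 z<s
agrees-++ (x ∷ w) σ σ≡w (suc q) (s≤s q<n+m) = agrees-++ w (λ v → σ (suc v)) (λ q q<n → σ≡w (suc q) (s≤s q<n)) q q<n+m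

members : ∀ {k} → Subset k → List ℕ
members [] = []
members (true ∷ p) = 0 ∷ map suc (members p)
members (false ∷ p) = map suc (members p)

Any-members⁻ : ∀ {k} (Q : ℕ → Set) (p : Subset k) → Any Q (members p) → ∃[ x ] (lookup p x ≡ true × Q (toℕ x))
Any-members⁻ Q (true ∷ p) (here q) = zero , refl , q
Any-members⁻ Q (true ∷ p) (there q) with Any-members⁻ (λ z → Q (suc z)) p (Anyₚ.map⁻ q)
... | x , x∈p , qx = suc x , x∈p , qx
Any-members⁻ Q (false ∷ p) q with Any-members⁻ (λ z → Q (suc z)) p (Anyₚ.map⁻ q)
... | x , x∈p , qx = suc x , x∈p , qx

Any-members⁺ : ∀ {k} (Q : ℕ → Set) (p : Subset k) x → lookup p x ≡ true → Q (toℕ x) → Any Q (members p)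
Any-members⁺ Q (true ∷ p) zero _ qx = here qx
Any-members⁺ Q (true ∷ p) (suc x) x∈p qx = there (Anyₚ.map⁺ (Any-members⁺ (λ z → Q (suc z)) p x x∈p qx))
Any-members⁺ Q (false ∷ p) (suc x) x∈p qx = Anyₚ.map⁺ (Any-members⁺ (λ z → Q (suc z)) p x x∈p qx)

length-members : ∀ {k} (p : Subset k) → length (members p) ≤ k
length-members [] = z≤n
length-members (true ∷ p) = s≤s (≤-trans (≤-reflexive (length-map suc (members p))) (length-members p))
length-members (false ∷ p) = ≤-trans (≤-reflexive (length-map suc (members p))) (m≤n⇒m≤1+n (length-members p))

members-< : ∀ {k} (p : Subset k) → All (_< k) (members p)
members-< [] = []
members-< (true ∷ p) = z<s ∷ Allₚ.map⁺ (All.map s≤s (members-< p))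
members-< (false ∷ p) = Allₚ.map⁺ (All.map s≤s (members-< p))

literals : ∀ {k} → ℕ → LitSet k → Clause
literals base (P , N) = map (λ x → base + x , true) (members P) ++ map (λ x → base + x , false) (members N)

module _ {k} (base : ℕ) (σ : ℕ → Bool) (a : Vec Bool k) (σ≡a : ∀ x → σ (base + toℕ x) ≡ lookup a x) where

  ClauseTrue-literals⁻ : ∀ L → ClauseTrue σ (literals base L) → SatClause a L
  ClauseTrue-literals⁻ (P , N) holds with Anyₚ.++⁻ (map (λ x → base + x , true) (members P)) holds
  ... | inj₁ holdsP with Any-members⁻ (λ z → σ (base + z) ≡ true) P (Anyₚ.map⁻ holdsP)
  ...   | x , x∈P , σx = x , inj₁ (x∈P , trans (sym (σ≡a x)) σx)
  ClauseTrue-literals⁻ (P , N) holds | inj₂ holdsN with Any-members⁻ (λ z → σ (base + z) ≡ false) N (Anyₚ.map⁻ holdsN)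
  ...   | x , x∈N , σx = x , inj₂ (x∈N , trans (sym (σ≡a x)) σx)

  ClauseTrue-literals⁺ : ∀ L → SatClause a L → ClauseTrue σ (literals base L)
  ClauseTrue-literals⁺ (P , N) (x , inj₁ (x∈P , ax)) =
    Anyₚ.++⁺ˡ (Anyₚ.map⁺ (Any-members⁺ (λ z → σ (base + z) ≡ true) P x x∈P (trans (σ≡a x) ax)))
  ClauseTrue-literals⁺ (P , N) (x , inj₂ (x∈N , ax)) =
    Anyₚ.++⁺ʳ (map (λ x → base + x , true) (members P))
      (Anyₚ.map⁺ (Any-members⁺ (λ z → σ (base + z) ≡ false) N x x∈N (trans (σ≡a x) ax)))

length-literals : ∀ {k} base (L : LitSet k) → length (literals base L) ≤ k + k
length-literals {k} base (P , N) = begin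
  length (literals base (P , N))                                  ≡⟨ length-++ (map _ (members P)) ⟩
  length (map _ (members P)) + length (map _ (members N))         ≡⟨ cong₂ _+_ (length-map _ (members P)) (length-map _ (members N)) ⟩
  length (members P) + length (members N)                         ≤⟨ +-mono-≤ (length-members P) (length-members N) ⟩
  k + k                                                           ∎
  where open ≤-Reasoning

literals-< : ∀ {k} base (L : LitSet k) → VarsBelow (base + k) (literals base L)
literals-< base (P , N) = Allₚ.++⁺ (Allₚ.map⁺ (All.map (+-monoʳ-< base) (members-< P)))
                                   (Allₚ.map⁺ (All.map (+-monoʳ-< base) (members-< N)))

stepBasic-inGet : ∀ {M} (bs : Vec Bool M) q s → q < M → stepBasic bs (inGet q) s ≡ just (lookupℕ bs q , s)
stepBasic-inGet {M} bs q s q<M with q <? M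
... | yes q<M' = cong (λ b → just (b , s)) (lookup-fromℕ< bs q q<M')
... | no q≮M = contradiction q<M q≮M

exec-inGet : ∀ {M} (bs : Vec Bool M) κ q rest s → q < M →
             exec bs (withKind κ (inGet q) ∷ rest) 0 s ≡ exec bs rest (skipped κ (lookupℕ bs q)) s
exec-inGet bs κ q rest s q<M = begin
  exec bs (withKind κ (inGet q) ∷ rest) 0 s                        ≡⟨ exec-∷ bs (withKind κ (inGet q)) rest s ⟩
  resume bs rest (step bs (withKind κ (inGet q)) s)                ≡⟨ cong (resume bs rest) (step-withKind bs κ (inGet q) s) ⟩
  resume bs rest (afterBasic κ (stepBasic bs (inGet q) s))         ≡⟨ cong (resume bs rest ∘ afterBasic κ) (stepBasic-inGet bs q s q<M) ⟩
  exec bs rest (skipped κ (lookupℕ bs q)) s                        ∎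
  where open ≡-Reasoning

agree : Bool → Bool → Bool
agree true b = b
agree false b = not b

agree-≡ : ∀ r b → agree r b ≡ true → r ≡ b
agree-≡ true true _ = refl
agree-≡ false false _ = refl

agree-≢ : ∀ r b → ¬ r ≡ b → agree r b ≡ false
agree-≢ true true r≢b = contradiction refl r≢b
agree-≢ true false _ = refl
agree-≢ false true _ = refl
agree-≢ false false r≢b = contradiction refl r≢b

agree-refl : ∀ b → agree b b ≡ true
agree-refl true = refl
agree-refl false = refl

testKind : Bool → Kind
testKind true = ptestᵏ
testKind false = ntestᵏ

skipped-testKind : ∀ r b → skipped (testKind b) r ≡ (if agree r b then 0 else 1)
skipped-testKind true true = refl
skipped-testKind true false = refl
skipped-testKind false true = refl
skipped-testKind false false = refl

-- Execution falls through to the continuation if some literal holds, and terminates otherwise.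
clauseCheck : Clause → List Instr
clauseCheck [] = halt ∷ []
clauseCheck ((q , b) ∷ C) = withKind (testKind b) (inGet q) ∷ jump (suc (length (clauseCheck C))) ∷ clauseCheck C

clauseᵇ : ∀ {M} → Vec Bool M → Clause → Bool
clauseᵇ bs [] = false
clauseᵇ bs ((q , b) ∷ C) = agree (lookupℕ bs q) b ∨ clauseᵇ bs C

exec-clauseCheck : ∀ {M} (bs : Vec Bool M) C rest s → VarsBelow M C →
  exec bs (clauseCheck C ++ rest) 0 s ≡ (if clauseᵇ bs C then exec bs rest 0 s else terminated (out s))
exec-clauseCheck bs [] rest s _ = refl
exec-clauseCheck bs ((q , b) ∷ C) rest s (q<M ∷ C<M)
  rewrite exec-inGet bs (testKind b) q (jump (suc (length (clauseCheck C))) ∷ clauseCheck C ++ rest) s q<M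
        | skipped-testKind (lookupℕ bs q) b
  with agree (lookupℕ bs q) b
... | true = exec-++ bs (clauseCheck C) rest s
... | false = exec-clauseCheck bs C rest s C<M

clauseᵇ⇒ClauseTrue : ∀ {M} (bs : Vec Bool M) C → clauseᵇ bs C ≡ true → ClauseTrue (lookupℕ bs) C
clauseᵇ⇒ClauseTrue bs ((q , b) ∷ C) holds with agree (lookupℕ bs q) b in agrees
... | true = here (agree-≡ _ _ agrees)
... | false = there (clauseᵇ⇒ClauseTrue bs C holds)

ClauseTrue⇒clauseᵇ : ∀ {M} (bs : Vec Bool M) C → ClauseTrue (lookupℕ bs) C → clauseᵇ bs C ≡ true
ClauseTrue⇒clauseᵇ bs ((q , b) ∷ C) (here bq≡b) rewrite bq≡b | agree-refl b = refl
ClauseTrue⇒clauseᵇ bs ((q , b) ∷ C) (there holds) rewrite ClauseTrue⇒clauseᵇ bs C holds with agree (lookupℕ bs q) b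
... | true = refl
... | false = refl

length-clauseCheck : ∀ C → length (clauseCheck C) ≡ suc (2 * length C)
length-clauseCheck [] = refl
length-clauseCheck (l ∷ C) = trans (cong (2 +_) (length-clauseCheck C)) (cong suc (sym (*-suc 2 (length C))))

GuardedClause : Set
GuardedClause = ℕ × Clause

guardedCheck : GuardedClause → List Instr
guardedCheck (i , C) = withKind ntestᵏ (inGet i) ∷ jump (suc (length (clauseCheck C))) ∷ clauseCheck C

guardedᵇ : ∀ {M} → Vec Bool M → GuardedClause → Bool
guardedᵇ bs (i , C) = not (lookupℕ bs i) ∨ clauseᵇ bs C

Guarded : ∀ {M} → Vec Bool M → GuardedClause → Set
Guarded bs (i , C) = lookupℕ bs i ≡ true → ClauseTrue (lookupℕ bs) C

InputsBelow : ℕ → GuardedClause → Set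
InputsBelow M (i , C) = i < M × VarsBelow M C

exec-guardedCheck : ∀ {M} (bs : Vec Bool M) g rest s → InputsBelow M g →
  exec bs (guardedCheck g ++ rest) 0 s ≡ (if guardedᵇ bs g then exec bs rest 0 s else terminated (out s))
exec-guardedCheck bs (i , C) rest s (i<M , C<M)
  rewrite exec-inGet bs ntestᵏ i (jump (suc (length (clauseCheck C))) ∷ clauseCheck C ++ rest) s i<M
  with lookupℕ bs i
... | true = exec-clauseCheck bs C rest s C<M
... | false = exec-++ bs (clauseCheck C) rest s

checker : List GuardedClause → List Instr
checker [] = plain (outSet true) ∷ halt ∷ []
checker (g ∷ gs) = guardedCheck g ++ checker gs

checkᵇ : ∀ {M} → Vec Bool M → List GuardedClause → Bool
checkᵇ bs [] = true
checkᵇ bs (g ∷ gs) = guardedᵇ bs g ∧ checkᵇ bs gs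

exec-checker : ∀ {M} (bs : Vec Bool M) gs s → out s ≡ false → All (InputsBelow M) gs →
  exec bs (checker gs) 0 s ≡ terminated (checkᵇ bs gs)
exec-checker bs [] s out≡false _ = refl
exec-checker bs (g ∷ gs) s out≡false (g<M ∷ gs<M)
  rewrite exec-guardedCheck bs g (checker gs) s g<M | exec-checker bs gs s out≡false gs<M
  with guardedᵇ bs g
... | true = refl
... | false = cong terminated out≡false

guardedᵇ⇒Guarded : ∀ {M} (bs : Vec Bool M) g → guardedᵇ bs g ≡ true → Guarded bs g
guardedᵇ⇒Guarded bs (i , C) holds bi≡true rewrite bi≡true = clauseᵇ⇒ClauseTrue bs C holds

Guarded⇒guardedᵇ : ∀ {M} (bs : Vec Bool M) g → Guarded bs g → guardedᵇ bs g ≡ true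
Guarded⇒guardedᵇ bs (i , C) guarded with lookupℕ bs i
... | true = ClauseTrue⇒clauseᵇ bs C (guarded refl)
... | false = refl

checkᵇ⇒Guarded : ∀ {M} (bs : Vec Bool M) gs → checkᵇ bs gs ≡ true → All (Guarded bs) gs
checkᵇ⇒Guarded bs [] _ = []
checkᵇ⇒Guarded bs (g ∷ gs) holds with guardedᵇ bs g in g-holds
... | true = guardedᵇ⇒Guarded bs g g-holds ∷ checkᵇ⇒Guarded bs gs holds

Guarded⇒checkᵇ : ∀ {M} (bs : Vec Bool M) gs → All (Guarded bs) gs → checkᵇ bs gs ≡ true
Guarded⇒checkᵇ bs [] [] = refl
Guarded⇒checkᵇ bs (g ∷ gs) (guarded ∷ all-guarded)
  rewrite Guarded⇒guardedᵇ bs g guarded = Guarded⇒checkᵇ bs gs all-guarded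

length-checker : ∀ gs B → All (λ g → length (proj₂ g) ≤ B) gs → length (checker gs) ≤ length gs * (3 + 2 * B) + 2
length-checker [] B _ = ≤-refl
length-checker ((i , C) ∷ gs) B (|C|≤B ∷ rest) = begin
  length (guardedCheck (i , C) ++ checker gs)                      ≡⟨ length-++ (guardedCheck (i , C)) ⟩
  2 + length (clauseCheck C) + length (checker gs)                 ≡⟨ cong (λ z → 2 + z + length (checker gs)) (length-clauseCheck C) ⟩
  3 + 2 * length C + length (checker gs)                           ≤⟨ +-mono-≤ (+-monoʳ-≤ 3 (*-monoʳ-≤ 2 |C|≤B)) (length-checker gs B rest) ⟩
  (3 + 2 * B) + (length gs * (3 + 2 * B) + 2)                      ≡⟨ +-assoc (3 + 2 * B) _ 2 ⟨
  suc (length gs) * (3 + 2 * B) + 2                                ∎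
  where open ≤-Reasoning

-- 3SATC belongs to NP_IS

2⌊n/2⌋≤n : ∀ n → ⌊ n /2⌋ + ⌊ n /2⌋ ≤ n
2⌊n/2⌋≤n n = ≤-trans (+-monoʳ-≤ ⌊ n /2⌋ (⌊n/2⌋≤⌈n/2⌉ n)) (≤-reflexive (⌊n/2⌋+⌈n/2⌉≡n n))

module Membership (α : (k : ℕ) → Fin (nd k) → LitSet k) where

  -- Clause i of level(n) is guarded by input i, and its variable x is read from input n + x.
  selectedClauses : ℕ → List GuardedClause
  selectedClauses n = List.tabulate (λ (i : Fin (nd (level n))) → toℕ i , literals n (α (level n) i))

  verifier : BoolFamily
  verifier N bs = checkᵇ bs (selectedClauses ⌊ N /2⌋)

  -- #1 only makes the sequence syntactically non-empty.
  verifierProgram : ℕ → InstrSeq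
  verifierProgram N = jump 1 ∷ checker (selectedClauses ⌊ N /2⌋)

  selectedClauses-inputsBelow : ∀ N → All.All (InputsBelow N) (selectedClauses ⌊ N /2⌋)
  selectedClauses-inputsBelow N = Allₚ.tabulate⁺ λ i →
      ≤-trans (toℕ<n i) (≤-trans (nd[level]≤ n) (⌊n/2⌋≤n N)) ,
      All.map (λ x<n+k → ≤-trans x<n+k (≤-trans (+-monoʳ-≤ n (level≤ n)) (2⌊n/2⌋≤n N))) (literals-< n (α (level n) i))
    where
    n : ℕ
    n = ⌊ N /2⌋

  verifierProgram-computes : ∀ N → Computes (verifierProgram N) (verifier N)
  verifierProgram-computes N bs = exec-checker bs (selectedClauses ⌊ N /2⌋) initState refl (selectedClauses-inputsBelow N)

  verifierProgram-length : ∀ N → len (verifierProgram N) ≤ ⟦ 3 ∷ 3 ∷ 4 ∷ [] ⟧ N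
  verifierProgram-length N = begin
    suc (length (checker gs))               ≤⟨ s≤s (length-checker gs (k + k) (Allₚ.tabulate⁺ λ i → length-literals n (α k i))) ⟩
    suc (length gs * (3 + 2 * (k + k)) + 2) ≤⟨ s≤s (+-monoˡ-≤ 2 (*-mono-≤ |gs|≤N (+-monoʳ-≤ 3 (*-monoʳ-≤ 2 (+-mono-≤ k≤N k≤N))))) ⟩
    suc (N * (3 + 2 * (N + N)) + 2)         ≡⟨ expand N ⟩
    ⟦ 3 ∷ 3 ∷ 4 ∷ [] ⟧ N                    ∎
    where
    open ≤-Reasoning
    n k : ℕ
    n = ⌊ N /2⌋
    k = level n
    gs : List GuardedClause
    gs = selectedClauses n
    |gs|≤N : length gs ≤ N
    |gs|≤N = ≤-trans (≤-reflexive (length-tabulate _)) (≤-trans (nd[level]≤ n) (⌊n/2⌋≤n N))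
    k≤N : k ≤ N
    k≤N = ≤-trans (level≤ n) (⌊n/2⌋≤n N)
    expand : ∀ N → suc (N * (3 + 2 * (N + N)) + 2) ≡ 3 + N * (3 + N * (4 + N * 0))
    expand = solve-∀

  verifier-P-IS : P-IS verifier
  verifier-P-IS = 3 ∷ 3 ∷ 4 ∷ [] , λ N → verifierProgram N , verifierProgram-length N , verifierProgram-computes N

  module _ (F : BoolFamily) (F-3SATC : Is3SATC α F) (n : ℕ) (w : Vec Bool n) where
    private
      k : ℕ
      k = level n
      selection : Fin (nd k) → Bool
      selection i = lookup w (inject≤ i (nd[level]≤ n))

    guard≡selection : ∀ (c : Vec Bool n) i → lookupℕ (w ++ᵛ c) (toℕ i) ≡ selection i
    guard≡selection c i = begin
      lookupℕ (w ++ᵛ c) (toℕ i)               ≡⟨ lookupℕ-++ˡ w c (toℕ i) (≤-trans (toℕ<n i) (nd[level]≤ n)) ⟩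
      lookupℕ w (toℕ i)                       ≡⟨ cong (lookupℕ w) (toℕ-inject≤ i (nd[level]≤ n)) ⟨
      lookupℕ w (toℕ (inject≤ i (nd[level]≤ n)))     ≡⟨ lookupℕ-toℕ w (inject≤ i (nd[level]≤ n)) ⟩
      selection i                             ∎
      where open ≡-Reasoning

    satisfiable⇒guarded : Satisfiable α k selection → ∃[ c ] All.All (Guarded (w ++ᵛ c)) (selectedClauses n)
    satisfiable⇒guarded (a , sat) = c , Allₚ.tabulate⁺ λ i guard →
        ClauseTrue-literals⁺ n (lookupℕ (w ++ᵛ c)) a reads-a (α k i) (sat i (trans (sym (guard≡selection c i)) guard))
      where
      c : Vec Bool n
      c = tabulate (λ y → lookupℕ a (toℕ y))
      reads-a : ∀ x → lookupℕ (w ++ᵛ c) (n + toℕ x) ≡ lookup a x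
      reads-a x = trans (lookupℕ-++ʳ w c (toℕ x))
                        (trans (lookupℕ-tabulate (lookupℕ a) (toℕ x) (≤-trans (toℕ<n x) (level≤ n))) (lookupℕ-toℕ a x))

    guarded⇒satisfiable : ∀ c → All.All (Guarded (w ++ᵛ c)) (selectedClauses n) → Satisfiable α k selection
    guarded⇒satisfiable c guarded = a , λ i selected →
        ClauseTrue-literals⁻ n (lookupℕ (w ++ᵛ c)) a reads-a (α k i)
          (Allₚ.tabulate⁻ guarded i (trans (guard≡selection c i) selected))
      where
      a : Vec Bool k
      a = tabulate (λ x → lookupℕ (w ++ᵛ c) (n + toℕ x))
      reads-a : ∀ x → lookupℕ (w ++ᵛ c) (n + toℕ x) ≡ lookup a x
      reads-a x = sym (lookup∘tabulate _ x)

    3SATC⇔verifier : (F n w ≡ true) ⇔ (Σ (Vec Bool n) λ c → verifier (n + n) (w ++ᵛ c) ≡ true)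
    3SATC⇔verifier = mk⇔
      (λ Fw → let c , guarded = satisfiable⇒guarded (Equivalence.to F⇔sat Fw)
              in c , subst (λ m → checkᵇ (w ++ᵛ c) (selectedClauses m) ≡ true) (n≡⌊n+n/2⌋ n)
                           (Guarded⇒checkᵇ (w ++ᵛ c) _ guarded))
      (λ (c , checks) → Equivalence.from F⇔sat (guarded⇒satisfiable c (checkᵇ⇒Guarded (w ++ᵛ c) _
                           (subst (λ m → checkᵇ (w ++ᵛ c) (selectedClauses m) ≡ true) (sym (n≡⌊n+n/2⌋ n)) checks))))
      where
      F⇔sat : (F n w ≡ true) ⇔ Satisfiable α k selection
      F⇔sat = F-3SATC k n (nd[level]≤ n) (proj₂ (level-spec n)) w

  3SATC∈NP-IS : (F : BoolFamily) → Is3SATC α F → NP-IS F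
  3SATC∈NP-IS F F-3SATC = 0 ∷ 1 ∷ [] , ⟦⟧-monotonic (0 ∷ 1 ∷ []) , verifier , verifier-P-IS ,
    λ n w → subst (λ m → (F n w ≡ true) ⇔ (Σ (Vec Bool m) λ c → verifier (n + m) (w ++ᵛ c) ≡ true))
                  (sym (⟦0∷1∷[]⟧ n)) (3SATC⇔verifier F F-3SATC n w)
    where
    ⟦0∷1∷[]⟧ : ∀ n → ⟦ 0 ∷ 1 ∷ [] ⟧ n ≡ n
    ⟦0∷1∷[]⟧ n = trans (cong (n *_) (cong suc (*-zeroʳ n))) (*-identityʳ n)

-- Runs as 3-CNFs

data Effect : Set where
  noEffect : Effect
  setOut   : Bool → Effect
  setAux   : ℕ → Bool → Effect

effectOf : Basic → Effect
effectOf (auxSet k b) = setAux k b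
effectOf (outSet b) = setOut b
effectOf _ = noEffect

apply : Effect → State → State
apply noEffect s = s
apply (setOut b) s = st (aux s) b
apply (setAux k b) s = st (update (aux s) k b) (out s)

stepBasic-effect : ∀ {N} (bs : Vec Bool N) a s r s' → stepBasic bs a s ≡ just (r , s') → s' ≡ apply (effectOf a) s
stepBasic-effect {N} bs (inGet q) s r s' e with q <? N
stepBasic-effect bs (inGet q) s r s' refl | yes _ = refl
stepBasic-effect bs (auxGet k) s r s' refl = refl
stepBasic-effect bs (auxSet k b) s r s' refl = refl
stepBasic-effect bs (outSet b) s r s' refl = refl

registerOfBasic : Basic → Maybe ℕ
registerOfBasic (auxGet k) = just k
registerOfBasic (auxSet k _) = just k
registerOfBasic _ = nothing

registerOf : Instr → Maybe ℕ
registerOf (plain a) = registerOfBasic a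
registerOf (ptest a) = registerOfBasic a
registerOf (ntest a) = registerOfBasic a
registerOf _ = nothing

registerOf-withKind : ∀ κ a → registerOf (withKind κ a) ≡ registerOfBasic a
registerOf-withKind plainᵏ a = refl
registerOf-withKind ptestᵏ a = refl
registerOf-withKind ntestᵏ a = refl

registerValue : Maybe ℕ → State → Bool
registerValue (just k) s = aux s k
registerValue nothing s = false

registerValue-initState : ∀ m → registerValue m initState ≡ false
registerValue-initState (just k) = refl
registerValue-initState nothing = refl

outWrite : Effect → Maybe Bool
outWrite (setOut b) = just b
outWrite _ = nothing

registerWrite : Effect → Maybe ℕ → Maybe Bool
registerWrite (setAux k b) (just k') with k' ≟ k
... | yes _ = just b
... | no _ = nothing
registerWrite _ _ = nothing

out-apply : ∀ e s → out (apply e s) ≡ fromMaybe (out s) (outWrite e)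
out-apply noEffect s = refl
out-apply (setOut b) s = refl
out-apply (setAux k b) s = refl

registerValue-apply : ∀ e m s → registerValue m (apply e s) ≡ fromMaybe (registerValue m s) (registerWrite e m)
registerValue-apply noEffect m s = refl
registerValue-apply (setOut b) (just k) s = refl
registerValue-apply (setOut b) nothing s = refl
registerValue-apply (setAux k b) nothing s = refl
registerValue-apply (setAux k b) (just k') s with k' ≟ k
... | yes refl = refl
... | no _ = refl

-- Where the reply of a basic instruction comes from; blocked is an illegal input read, which has none.
data Source : Set where
  var     : ℕ → Source
  const   : Bool → Source
  blocked : Source

SourceValue : (ℕ → Bool) → Source → Bool → Set
SourceValue σ (var v) r = σ v ≡ r
SourceValue σ (const b) r = b ≡ r
SourceValue σ blocked r = ⊥

resolve₂ : ∀ {σ v₁ b₁ l} → ClauseTrue σ ((v₁ , b₁) ∷ l ∷ []) → σ v₁ ≡ not b₁ → LiteralTrue σ l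
resolve₂ {b₁ = true} (here l₁) ¬l₁ = contradiction (trans (sym l₁) ¬l₁) λ ()
resolve₂ {b₁ = false} (here l₁) ¬l₁ = contradiction (trans (sym l₁) ¬l₁) λ ()
resolve₂ (there (here l)) _ = l

resolve₃ : ∀ {σ v₁ b₁ v₂ b₂ l} → ClauseTrue σ ((v₁ , b₁) ∷ (v₂ , b₂) ∷ l ∷ []) →
           σ v₁ ≡ not b₁ → σ v₂ ≡ not b₂ → LiteralTrue σ l
resolve₃ {σ} {l = l} (here l₁) ¬l₁ _ = resolve₂ {σ} {l = l} (here l₁) ¬l₁
resolve₃ (there l₂,₃) _ ¬l₂ = resolve₂ l₂,₃ ¬l₂

-- Under the guard ev, y copies x or takes the written value.
assign : ℕ → Maybe Bool → ℕ → ℕ → List Clause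
assign ev (just b) x y = ((ev , false) ∷ (y , b) ∷ []) ∷ []
assign ev nothing x y = ((ev , false) ∷ (x , false) ∷ (y , true) ∷ []) ∷ ((ev , false) ∷ (x , true) ∷ (y , false) ∷ []) ∷ []

assign-sound : ∀ {σ} ev m x y → CNFTrue σ (assign ev m x y) → σ ev ≡ true → σ y ≡ fromMaybe (σ x) m
assign-sound ev (just b) x y (c ∷ []) guard = resolve₂ c guard
assign-sound {σ} ev nothing x y (c₁ ∷ c₂ ∷ []) guard with σ x in σx
... | true = resolve₃ c₁ guard σx
... | false = resolve₃ c₂ guard σx

assign-complete : ∀ {σ} ev m x y → σ y ≡ fromMaybe (σ x) m → CNFTrue σ (assign ev m x y)
assign-complete ev (just b) x y σy = there (here σy) ∷ []
assign-complete {σ} ev nothing x y σy with σ x in σx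
... | true = there (there (here σy)) ∷ there (here σx) ∷ []
... | false = there (here σx) ∷ there (there (here σy)) ∷ []

assign-unguarded : ∀ {σ} ev m x y → σ ev ≡ false → CNFTrue σ (assign ev m x y)
assign-unguarded ev (just b) x y ¬guard = here ¬guard ∷ []
assign-unguarded ev nothing x y ¬guard = here ¬guard ∷ here ¬guard ∷ []

concatUpTo : ∀ {A : Set} → ℕ → (ℕ → List A) → List A
concatUpTo n f = concat (applyUpTo f n)

All-concatUpTo⁺ : ∀ {A : Set} {P : A → Set} n f → (∀ {j} → j < n → All P (f j)) → All P (concatUpTo n f)
All-concatUpTo⁺ n f all-f = Allₚ.concat⁺ (Allₚ.applyUpTo⁺₁ f n all-f)

All-concatUpTo⁻ : ∀ {A : Set} {P : A → Set} n f → All P (concatUpTo n f) → ∀ {j} → j < n → All P (f j)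
All-concatUpTo⁻ n f all = Allₚ.applyUpTo⁻ f n (Allₚ.concat⁻ all)

-- Variables 0 … N-1 are the inputs; position i < L of the program owns the W variables
-- N + (f + i * W), f < W: reached, content of out on arrival, reply T taken, reply F taken,
-- and for each position j the content on arrival of the auxiliary register used at j.
module Encoding (N : ℕ) (Xl : List Instr) where

  L : ℕ
  L = length Xl

  W : ℕ
  W = 4 + L

  K : ℕ
  K = N + L * W

  field# : ℕ → ℕ → ℕ
  field# i f = N + (f + i * W)

  reached : ℕ → ℕ
  reached i = field# i 0

  outAt : ℕ → ℕ
  outAt i = field# i 1

  tookField : Bool → ℕ
  tookField true = 2
  tookField false = 3

  took : ℕ → Bool → ℕ
  took i b = field# i (tookField b)

  slot : ℕ → ℕ → ℕ
  slot i j = field# i (4 + j)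

  instrAt : ℕ → Maybe Instr
  instrAt i = head (drop i Xl)

  registerAt : ℕ → Maybe ℕ
  registerAt j = instrAt j >>= registerOf

  sourceOf : ℕ → Basic → Source
  sourceOf i (inGet q) with q <? N
  ... | yes _ = var q
  ... | no _ = blocked
  sourceOf i (auxGet k) = var (slot i i)
  sourceOf i (auxSet k b) = const b
  sourceOf i (outSet b) = const b

  entryClauses : ℕ → Source → List Clause
  entryClauses i (var v) = ((reached i , false) ∷ (v , false) ∷ (took i true , true) ∷ []) ∷
                           ((reached i , false) ∷ (v , true) ∷ (took i false , true) ∷ []) ∷ []
  entryClauses i (const b) = ((reached i , false) ∷ (took i b , true) ∷ []) ∷ []
  entryClauses i blocked = []

  -- Targets beyond the program lead to inaction and need no clauses.
  edgeClauses : ℕ → ℕ → ℕ → Effect → List Clause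
  edgeClauses ev i t e with t <? L
  ... | yes _ = ((ev , false) ∷ (reached t , true) ∷ []) ∷
                (assign ev (outWrite e) (outAt i) (outAt t) ++
                 concatUpTo L (λ j → assign ev (registerWrite e (registerAt j)) (slot i j) (slot t j)))
  ... | no _ = []

  transitionClauses : ℕ → Source → (Bool → ℕ) → Effect → List Clause
  transitionClauses i src skip e = entryClauses i src ++
    (edgeClauses (took i true) i (i + suc (skip true)) e ++ edgeClauses (took i false) i (i + suc (skip false)) e)

  instrClauses : ℕ → Instr → List Clause
  instrClauses i (plain a) = transitionClauses i (sourceOf i a) (skipped plainᵏ) (effectOf a)
  instrClauses i (ptest a) = transitionClauses i (sourceOf i a) (skipped ptestᵏ) (effectOf a)
  instrClauses i (ntest a) = transitionClauses i (sourceOf i a) (skipped ntestᵏ) (effectOf a)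
  instrClauses i (jump zero) = []
  instrClauses i (jump (suc l)) = transitionClauses i (const true) (λ _ → l) noEffect
  instrClauses i halt = ((reached i , false) ∷ (outAt i , true) ∷ []) ∷ []

  instrClauses-withKind : ∀ i κ a → instrClauses i (withKind κ a) ≡ transitionClauses i (sourceOf i a) (skipped κ) (effectOf a)
  instrClauses-withKind i plainᵏ a = refl
  instrClauses-withKind i ptestᵏ a = refl
  instrClauses-withKind i ntestᵏ a = refl

  initialClauses : List Clause
  initialClauses = ((reached 0 , true) ∷ []) ∷ ((outAt 0 , false) ∷ []) ∷ concatUpTo L (λ j → ((slot 0 j , false) ∷ []) ∷ [])

  programClauses : List Clause
  programClauses = concatUpTo L (λ i → maybe′ (instrClauses i) [] (instrAt i))

  encoding : List Clause
  encoding = initialClauses ++ programClauses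

  All-programClauses⁻ : ∀ {P : Clause → Set} → All P programClauses → ∀ i {u us} → drop i Xl ≡ u ∷ us → All P (instrClauses i u)
  All-programClauses⁻ {P} all i d =
    subst (λ m → All P (maybe′ (instrClauses i) [] m)) (cong head d) (All-concatUpTo⁻ L _ all (drop-∷⇒< Xl i d))

  All-programClauses⁺ : ∀ {P : Clause → Set} → (∀ i {u us} → drop i Xl ≡ u ∷ us → All P (instrClauses i u)) → All P programClauses
  All-programClauses⁺ {P} all = All-concatUpTo⁺ L _ λ {i} _ → at i
    where
    at : ∀ i → All P (maybe′ (instrClauses i) [] (instrAt i))
    at i with drop i Xl in d
    ... | [] = []
    ... | u ∷ us = all i d

  sourceOf-value : ∀ (bs : Vec Bool N) σ i a s r s' → (∀ q → q < N → σ q ≡ lookupℕ bs q) →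
                   σ (slot i i) ≡ registerValue (registerAt i) s → registerAt i ≡ registerOfBasic a →
                   stepBasic bs a s ≡ just (r , s') → SourceValue σ (sourceOf i a) r
  sourceOf-value bs σ i (inGet q) s r s' σ-inputs _ _ step≡ with q <? N
  sourceOf-value bs σ i (inGet q) s r s' σ-inputs _ _ refl | yes q<N = trans (σ-inputs q q<N) (sym (lookup-fromℕ< bs q q<N))
  sourceOf-value bs σ i (auxGet k) s r s' _ σslot reg≡ refl = trans σslot (cong (λ m → registerValue m s) reg≡)
  sourceOf-value bs σ i (auxSet k b) s r s' _ _ _ refl = refl
  sourceOf-value bs σ i (outSet b) s r s' _ _ _ refl = refl

-- Soundness and completeness of the encoding

module Soundness (N : ℕ) (Xl : List Instr) (σ : ℕ → Bool) (bs : Vec Bool N)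
                 (σ-encoding : CNFTrue σ (Encoding.encoding N Xl))
                 (σ-inputs : ∀ q → q < N → σ q ≡ lookupℕ bs q) where

  open Encoding N Xl

  Arrived : ℕ → State → Set
  Arrived p s = σ (reached p) ≡ true × σ (outAt p) ≡ out s × (∀ j → j < L → σ (slot p j) ≡ registerValue (registerAt j) s)

  Invariant : ℕ → State → Set
  Invariant p s = p < L → Arrived p s

  edge-sound : ∀ ev i t e s → σ ev ≡ true → Arrived i s → CNFTrue σ (edgeClauses ev i t e) → Invariant t (apply e s)
  edge-sound ev i t e s guard (_ , σout , σslots) clauses with t <? L
  ... | no t≮L = λ t<L → contradiction t<L t≮L
  ... | yes _ with clauses
  ...   | reached-t ∷ effects = λ _ → resolve₂ reached-t guard , out-t , slots-t
    where
    out-t : σ (outAt t) ≡ out (apply e s)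
    out-t = begin
      σ (outAt t)                             ≡⟨ assign-sound ev (outWrite e) (outAt i) (outAt t) (Allₚ.++⁻ˡ (assign ev (outWrite e) (outAt i) (outAt t)) effects) guard ⟩
      fromMaybe (σ (outAt i)) (outWrite e)    ≡⟨ cong (λ b → fromMaybe b (outWrite e)) σout ⟩
      fromMaybe (out s) (outWrite e)          ≡⟨ out-apply e s ⟨
      out (apply e s)                         ∎
      where open ≡-Reasoning
    slots-t : ∀ j → j < L → σ (slot t j) ≡ registerValue (registerAt j) (apply e s)
    slots-t j j<L = begin
      σ (slot t j)                                                   ≡⟨ assign-sound ev _ (slot i j) (slot t j)
                                                                          (All-concatUpTo⁻ L _ (Allₚ.++⁻ʳ (assign ev (outWrite e) (outAt i) (outAt t)) effects) j<L) guard ⟩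
      fromMaybe (σ (slot i j)) (registerWrite e (registerAt j))      ≡⟨ cong (λ b → fromMaybe b (registerWrite e (registerAt j))) (σslots j j<L) ⟩
      fromMaybe (registerValue (registerAt j) s) (registerWrite e (registerAt j)) ≡⟨ registerValue-apply e (registerAt j) s ⟨
      registerValue (registerAt j) (apply e s)                       ∎
      where open ≡-Reasoning

  entry-sound : ∀ i src r → σ (reached i) ≡ true → SourceValue σ src r → CNFTrue σ (entryClauses i src) → σ (took i r) ≡ true
  entry-sound i (var v) true σreached σv (c ∷ _ ∷ []) = resolve₃ c σreached σv
  entry-sound i (var v) false σreached σv (_ ∷ c ∷ []) = resolve₃ c σreached σv
  entry-sound i (const b) .b σreached refl (c ∷ []) = resolve₂ c σreached

  transition-sound : ∀ i src skip e s r → Arrived i s → CNFTrue σ (transitionClauses i src skip e) →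
                     SourceValue σ src r → Invariant (i + suc (skip r)) (apply e s)
  transition-sound i src skip e s r arrived clauses σsrc =
    take r (entry-sound i src r (proj₁ arrived) σsrc (Allₚ.++⁻ˡ (entryClauses i src) clauses))
    where
    edges : CNFTrue σ (edgeClauses (took i true) i (i + suc (skip true)) e ++ edgeClauses (took i false) i (i + suc (skip false)) e)
    edges = Allₚ.++⁻ʳ (entryClauses i src) clauses
    take : ∀ r → σ (took i r) ≡ true → Invariant (i + suc (skip r)) (apply e s)
    take true σtook = edge-sound _ i _ e s σtook arrived (Allₚ.++⁻ˡ _ edges)
    take false σtook = edge-sound _ i _ e s σtook arrived (Allₚ.++⁻ʳ _ edges)

  StepSound : ℕ → Step → Set
  StepSound i (advance k s') = Invariant (i + suc k) s'
  StepSound i (finish o) = ∀ b → o ≡ terminated b → b ≡ true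

  step-sound : ∀ i u s → i < L → registerAt i ≡ registerOf u → Arrived i s → CNFTrue σ (instrClauses i u) →
               StepSound i (step bs u s)
  step-sound i u s i<L reg≡ arrived clauses with instrView u
  ... | basic κ a rewrite step-withKind bs κ a s with stepBasic bs a s in step≡
  ...   | nothing = λ _ ()
  ...   | just (r , s') = subst (Invariant (i + suc (skipped κ r))) (sym (stepBasic-effect bs a s r s' step≡))
                            (transition-sound i _ (skipped κ) _ s r arrived
                              (subst (CNFTrue σ) (instrClauses-withKind i κ a) clauses)
                              (sourceOf-value bs σ i a s r s' σ-inputs (proj₂ (proj₂ arrived) i i<L) (trans reg≡ (registerOf-withKind κ a)) step≡))
  step-sound i u s i<L reg≡ arrived clauses | jump zero = λ _ ()
  step-sound i u s i<L reg≡ arrived clauses | jump (suc l) = transition-sound i (const true) (λ _ → l) noEffect s true arrived clauses refl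
  step-sound i u s i<L reg≡ (σreached , σout , _) (c ∷ []) | halt = λ { b refl → trans (sym σout) (resolve₂ c σreached) }

  run-sound : ∀ us i k s b → drop i Xl ≡ us → Invariant (i + k) s → exec bs us k s ≡ terminated b → b ≡ true
  run-sound [] i k s b _ _ ()
  run-sound (u ∷ us) i (suc k) s b d inv e =
    run-sound us (suc i) k s b (drop-∷ Xl i d) (subst (λ p → Invariant p s) (+-suc i k) inv) e
  run-sound (u ∷ us) i zero s b d inv e = continue (step bs u s) stepped (trans (sym (exec-∷ bs u us s)) e)
    where
    i<L : i < L
    i<L = drop-∷⇒< Xl i d
    stepped : StepSound i (step bs u s)
    stepped = step-sound i u s i<L (cong (λ xs → head xs >>= registerOf) d)
                (subst (λ p → Invariant p s) (+-identityʳ i) inv i<L)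
                (All-programClauses⁻ (Allₚ.++⁻ʳ initialClauses σ-encoding) i d)
    continue : ∀ st → StepSound i st → resume bs us st ≡ terminated b → b ≡ true
    continue (advance k s') inv' e' = run-sound us (suc i) k s' b (drop-∷ Xl i d) (subst (λ p → Invariant p s') (+-suc i k) inv') e'
    continue (finish o) sound e' = sound b e'

  initial-sound : Invariant 0 initState
  initial-sound _ = unit (All.head initial) , unit (All.head (All.tail initial)) , σslots
    where
    initial : CNFTrue σ initialClauses
    initial = Allₚ.++⁻ˡ initialClauses σ-encoding
    unit : ∀ {l} → ClauseTrue σ (l ∷ []) → LiteralTrue σ l
    unit (here holds) = holds
    σslots : ∀ j → j < L → σ (slot 0 j) ≡ registerValue (registerAt j) initState
    σslots j j<L = trans (unit (All.head (All-concatUpTo⁻ L _ (All.tail (All.tail initial)) j<L)))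
                         (sym (registerValue-initState (registerAt j)))

  soundness : ∀ b → exec bs Xl 0 initState ≡ terminated b → b ≡ true
  soundness b = run-sound Xl 0 0 initState b refl initial-sound

module Completeness (N : ℕ) (Xl : List Instr) (bs : Vec Bool N) (nonempty : 0 < Data.List.length Xl)
                    (accepts : exec bs Xl 0 initState ≡ terminated true) where

  open Encoding N Xl

  arrival : ℕ → Maybe State
  arrival = stateAt bs Xl 0 initState

  replyOf : Instr → State → Maybe Bool
  replyOf (plain a) s = Maybe.map proj₁ (stepBasic bs a s)
  replyOf (ptest a) s = Maybe.map proj₁ (stepBasic bs a s)
  replyOf (ntest a) s = Maybe.map proj₁ (stepBasic bs a s)
  replyOf (jump zero) s = nothing
  replyOf (jump (suc l)) s = just true
  replyOf halt s = nothing

  replyOf-withKind : ∀ κ a s → replyOf (withKind κ a) s ≡ Maybe.map proj₁ (stepBasic bs a s)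
  replyOf-withKind plainᵏ a s = refl
  replyOf-withKind ptestᵏ a s = refl
  replyOf-withKind ntestᵏ a s = refl

  tookValue : ℕ → State → Bool → Bool
  tookValue i s b = maybe′ (λ r → agree r b) false (instrAt i >>= λ u → replyOf u s)

  fieldValue : ℕ → State → ℕ → Bool
  fieldValue i s 0 = true
  fieldValue i s 1 = out s
  fieldValue i s 2 = tookValue i s true
  fieldValue i s 3 = tookValue i s false
  fieldValue i s (suc (suc (suc (suc j)))) = registerValue (registerAt j) s

  -- Fields of positions that are never reached are false.
  σ : ℕ → Bool
  σ = lookupℕ (bs ++ᵛ grid (λ i f → maybe′ (λ s → fieldValue i s f) false (arrival i)) L W)

  σ-inputs : ∀ q → q < N → σ q ≡ lookupℕ bs q
  σ-inputs q q<N = lookupℕ-++ˡ bs _ q q<N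

  σ-field : ∀ i f → i < L → f < W → σ (field# i f) ≡ maybe′ (λ s → fieldValue i s f) false (arrival i)
  σ-field i f i<L f<W = trans (lookupℕ-++ʳ bs _ (f + i * W)) (lookupℕ-grid _ L W i f i<L f<W)

  tookField<W : ∀ b → tookField b < W
  tookField<W true = s≤s (s≤s (s≤s z≤n))
  tookField<W false = s≤s (s≤s (s≤s (s≤s z≤n)))

  module Arrived {i s} (i<L : i < L) (arrived : arrival i ≡ just s) where

    value : ∀ f → f < W → σ (field# i f) ≡ fieldValue i s f
    value f f<W = trans (σ-field i f i<L f<W) (cong (maybe′ (λ s → fieldValue i s f) false) arrived)

    σ-reached : σ (reached i) ≡ true
    σ-reached = value 0 z<s

    σ-outAt : σ (outAt i) ≡ out s
    σ-outAt = value 1 (s≤s z<s)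

    σ-took : ∀ b → σ (took i b) ≡ tookValue i s b
    σ-took true = value 2 (tookField<W true)
    σ-took false = value 3 (tookField<W false)

    σ-slot : ∀ j → j < L → σ (slot i j) ≡ registerValue (registerAt j) s
    σ-slot j j<L = value (4 + j) (s≤s (s≤s (s≤s (s≤s j<L))))

  module Unreached {i} (i<L : i < L) (unreached : arrival i ≡ nothing) where

    value : ∀ f → f < W → σ (field# i f) ≡ false
    value f f<W = trans (σ-field i f i<L f<W) (cong (maybe′ (λ s → fieldValue i s f) false) unreached)

    σ-reached : σ (reached i) ≡ false
    σ-reached = value 0 z<s

    σ-took : ∀ b → σ (took i b) ≡ false
    σ-took b = value (tookField b) (tookField<W b)

  edge-complete : ∀ ev i t e s → i < L → arrival i ≡ just s → (t < L → arrival t ≡ just (apply e s)) →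
                  CNFTrue σ (edgeClauses ev i t e)
  edge-complete ev i t e s i<L arrived next with t <? L
  ... | no _ = []
  ... | yes t<L = there (here Aₜ.σ-reached) ∷
                  Allₚ.++⁺ (assign-complete ev _ (outAt i) (outAt t) out-t)
                           (All-concatUpTo⁺ L _ λ j<L → assign-complete ev _ (slot i _) (slot t _) (slot-t _ j<L))
    where
    module Aᵢ = Arrived i<L arrived
    module Aₜ = Arrived t<L (next t<L)
    out-t : σ (outAt t) ≡ fromMaybe (σ (outAt i)) (outWrite e)
    out-t = trans Aₜ.σ-outAt (trans (out-apply e s) (cong (λ b → fromMaybe b (outWrite e)) (sym Aᵢ.σ-outAt)))
    slot-t : ∀ j → j < L → σ (slot t j) ≡ fromMaybe (σ (slot i j)) (registerWrite e (registerAt j))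
    slot-t j j<L = trans (Aₜ.σ-slot j j<L) (trans (registerValue-apply e (registerAt j) s)
                     (cong (λ b → fromMaybe b (registerWrite e (registerAt j))) (sym (Aᵢ.σ-slot j j<L))))

  edge-unguarded : ∀ ev i t e → σ ev ≡ false → CNFTrue σ (edgeClauses ev i t e)
  edge-unguarded ev i t e ¬guard with t <? L
  ... | no _ = []
  ... | yes _ = here ¬guard ∷ Allₚ.++⁺ (assign-unguarded ev _ _ _ ¬guard) (All-concatUpTo⁺ L _ λ _ → assign-unguarded ev _ _ _ ¬guard)

  entry-complete : ∀ i src r → SourceValue σ src r → (∀ b → σ (took i b) ≡ agree r b) → CNFTrue σ (entryClauses i src)
  entry-complete i (var v) true σv σtook = there (there (here (σtook true))) ∷ there (here σv) ∷ []
  entry-complete i (var v) false σv σtook = there (here σv) ∷ there (there (here (σtook false))) ∷ []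
  entry-complete i (const b) .b refl σtook = there (here (trans (σtook b) (agree-refl b))) ∷ []

  entry-unreached : ∀ i src → σ (reached i) ≡ false → CNFTrue σ (entryClauses i src)
  entry-unreached i (var v) ¬reached = here ¬reached ∷ here ¬reached ∷ []
  entry-unreached i (const b) ¬reached = here ¬reached ∷ []
  entry-unreached i blocked ¬reached = []

  transition-complete : ∀ i src skip e s r → i < L → arrival i ≡ just s → SourceValue σ src r →
    (∀ b → σ (took i b) ≡ agree r b) → (i + suc (skip r) < L → arrival (i + suc (skip r)) ≡ just (apply e s)) →
    CNFTrue σ (transitionClauses i src skip e)
  transition-complete i src skip e s r i<L arrived σsrc σtook next =
    Allₚ.++⁺ (entry-complete i src r σsrc σtook) (Allₚ.++⁺ (edge true) (edge false))
    where
    edge : ∀ b → CNFTrue σ (edgeClauses (took i b) i (i + suc (skip b)) e)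
    edge b with r Data.Bool.≟ b
    ... | yes refl = edge-complete _ i _ e s i<L arrived next
    ... | no r≢b = edge-unguarded _ i _ e (trans (σtook b) (agree-≢ r b r≢b))

  transition-unreached : ∀ i src skip e → σ (reached i) ≡ false → (∀ b → σ (took i b) ≡ false) →
    CNFTrue σ (transitionClauses i src skip e)
  transition-unreached i src skip e ¬reached ¬took =
    Allₚ.++⁺ (entry-unreached i src ¬reached) (Allₚ.++⁺ (edge-unguarded _ i _ e (¬took true)) (edge-unguarded _ i _ e (¬took false)))

  next-arrival : ∀ i s u us k s' → arrival i ≡ just s → drop i Xl ≡ u ∷ us → step bs u s ≡ advance k s' →
                 i + suc k < L → arrival (i + suc k) ≡ just s'
  next-arrival i s u us k s' arrived d step≡ i+1+k<L = begin
    arrival (i + suc k)                        ≡⟨ stateAt-+ bs Xl 0 initState i s (suc k) arrived ⟩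
    stateAt bs (drop i Xl) 0 s (suc k)         ≡⟨ cong (λ xs → stateAt bs xs 0 s (suc k)) d ⟩
    stateAfter bs us (step bs u s) k           ≡⟨ cong (λ st → stateAfter bs us st k) step≡ ⟩
    stateAt bs us k s' k                       ≡⟨ stateAt-start bs us k s' k<|us| ⟩
    just s'                                    ∎
    where
    open ≡-Reasoning
    k<|us| : k < Data.List.length us
    k<|us| = s<s⁻¹ (+-cancelˡ-< i (suc k) _ (subst (i + suc k <_) (length-drop-∷ Xl i d) i+1+k<L))

  accepted-from : ∀ i s u us → arrival i ≡ just s → drop i Xl ≡ u ∷ us → resume bs us (step bs u s) ≡ terminated true
  accepted-from i s u us arrived d = begin
    resume bs us (step bs u s)     ≡⟨ exec-∷ bs u us s ⟨
    exec bs (u ∷ us) 0 s           ≡⟨ cong (λ xs → exec bs xs 0 s) d ⟨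
    exec bs (drop i Xl) 0 s        ≡⟨ exec-stateAt bs Xl 0 initState i s arrived ⟨
    exec bs Xl 0 initState         ≡⟨ accepts ⟩
    terminated true                ∎
    where open ≡-Reasoning

  σ-took-at : ∀ i s u us b → arrival i ≡ just s → drop i Xl ≡ u ∷ us →
              σ (took i b) ≡ maybe′ (λ r → agree r b) false (replyOf u s)
  σ-took-at i s u us b arrived d =
    trans (Arrived.σ-took (drop-∷⇒< Xl i d) arrived b)
          (cong (λ m → maybe′ (λ r → agree r b) false (m >>= λ u → replyOf u s)) (cong head d))

  reached-complete : ∀ i s u us → arrival i ≡ just s → drop i Xl ≡ u ∷ us → CNFTrue σ (instrClauses i u)
  reached-complete i s u us arrived d with instrView u | accepted-from i s u us arrived d
  ... | basic κ a | accepted rewrite step-withKind bs κ a s with stepBasic bs a s in step≡ | accepted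
  ...   | just (r , s') | _ = subst (CNFTrue σ) (sym (instrClauses-withKind i κ a))
            (transition-complete i _ (skipped κ) _ s r i<L arrived
              (sourceOf-value bs σ i a s r s' σ-inputs (Arrived.σ-slot i<L arrived i i<L) reg≡ step≡)
              σtook
              (subst (λ s″ → i + suc (skipped κ r) < L → arrival _ ≡ just s″) (stepBasic-effect bs a s r s' step≡)
                (next-arrival i s _ us _ s' arrived d (trans (step-withKind bs κ a s) (cong (afterBasic κ) step≡)))))
    where
    i<L : i < L
    i<L = drop-∷⇒< Xl i d
    reg≡ : registerAt i ≡ registerOfBasic a
    reg≡ = trans (cong (λ xs → head xs >>= registerOf) d) (registerOf-withKind κ a)
    σtook : ∀ b → σ (took i b) ≡ agree r b
    σtook b = trans (σ-took-at i s _ us b arrived d)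
                    (cong (maybe′ (λ r → agree r b) false) (trans (replyOf-withKind κ a s) (cong (Maybe.map proj₁) step≡)))
  reached-complete i s u us arrived d | jump zero | _ = []
  reached-complete i s u us arrived d | jump (suc l) | _ =
    transition-complete i (const true) (λ _ → l) noEffect s true (drop-∷⇒< Xl i d) arrived refl
      (λ b → σ-took-at i s _ us b arrived d) (next-arrival i s _ us l s arrived d refl)
  reached-complete i s u us arrived d | halt | out≡true =
    there (here (trans (Arrived.σ-outAt (drop-∷⇒< Xl i d) arrived) (terminated-injective out≡true))) ∷ []
    where
    terminated-injective : ∀ {b c} → terminated b ≡ terminated c → b ≡ c
    terminated-injective refl = refl

  unreached-complete : ∀ i u → i < L → arrival i ≡ nothing → CNFTrue σ (instrClauses i u)
  unreached-complete i u i<L unreached with instrView u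
  ... | basic κ a = subst (CNFTrue σ) (sym (instrClauses-withKind i κ a)) (transition-unreached i (sourceOf i a) (skipped κ) (effectOf a) U.σ-reached U.σ-took)
    where module U = Unreached i<L unreached
  ... | jump zero = []
  ... | jump (suc l) = transition-unreached i (const true) (λ _ → l) noEffect U.σ-reached U.σ-took
    where module U = Unreached i<L unreached
  ... | halt = here (Unreached.σ-reached i<L unreached) ∷ []

  position-complete : ∀ i {u us} → drop i Xl ≡ u ∷ us → CNFTrue σ (instrClauses i u)
  position-complete i {u} {us} d with arrival i in arrived
  ... | just s = reached-complete i s u us arrived d
  ... | nothing = unreached-complete i u (drop-∷⇒< Xl i d) arrived

  initial-complete : CNFTrue σ initialClauses
  initial-complete = here Start.σ-reached ∷ here Start.σ-outAt ∷
                     All-concatUpTo⁺ L _ (λ {j} j<L → here (trans (Start.σ-slot j j<L) (registerValue-initState (registerAt j))) ∷ [])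
    where module Start = Arrived nonempty (stateAt-start bs Xl 0 initState nonempty)

  completeness : CNFTrue σ encoding
  completeness = Allₚ.++⁺ initial-complete (All-programClauses⁺ position-complete)

WellFormed : ℕ → Clause → Set
WellFormed K C = VarsBelow K C × 1 ≤ length C × length C ≤ 3

wf₁ : ∀ {K v₁ b₁} → v₁ < K → WellFormed K ((v₁ , b₁) ∷ [])
wf₁ v₁<K = (v₁<K ∷ []) , s≤s z≤n , s≤s z≤n

wf₂ : ∀ {K v₁ b₁ v₂ b₂} → v₁ < K → v₂ < K → WellFormed K ((v₁ , b₁) ∷ (v₂ , b₂) ∷ [])
wf₂ v₁<K v₂<K = (v₁<K ∷ v₂<K ∷ []) , s≤s z≤n , s≤s (s≤s z≤n)

wf₃ : ∀ {K v₁ b₁ v₂ b₂ v₃ b₃} → v₁ < K → v₂ < K → v₃ < K → WellFormed K ((v₁ , b₁) ∷ (v₂ , b₂) ∷ (v₃ , b₃) ∷ [])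
wf₃ v₁<K v₂<K v₃<K = (v₁<K ∷ v₂<K ∷ v₃<K ∷ []) , s≤s z≤n , s≤s (s≤s (s≤s z≤n))

assign-wellFormed : ∀ {K} ev m x y → ev < K → x < K → y < K → All (WellFormed K) (assign ev m x y)
assign-wellFormed ev (just b) x y ev<K x<K y<K = wf₂ ev<K y<K ∷ []
assign-wellFormed ev nothing x y ev<K x<K y<K = wf₃ ev<K x<K y<K ∷ wf₃ ev<K x<K y<K ∷ []

module WellFormedness (N : ℕ) (Xl : List Instr) where

  open Encoding N Xl

  input<K : ∀ {q} → q < N → q < K
  input<K q<N = ≤-trans q<N (m≤m+n N _)

  field#<K : ∀ {i f} → i < L → f < W → field# i f < K
  field#<K i<L f<W = +-monoʳ-< N (grid-index< i<L f<W)

  reached<K : ∀ {i} → i < L → reached i < K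
  reached<K i<L = field#<K i<L z<s

  outAt<K : ∀ {i} → i < L → outAt i < K
  outAt<K i<L = field#<K i<L (s≤s z<s)

  took<K : ∀ {i} b → i < L → took i b < K
  took<K true i<L = field#<K i<L (s≤s (s≤s z<s))
  took<K false i<L = field#<K i<L (s≤s (s≤s (s≤s z<s)))

  slot<K : ∀ {i j} → i < L → j < L → slot i j < K
  slot<K i<L j<L = field#<K i<L (s≤s (s≤s (s≤s (s≤s j<L))))

  edge-wellFormed : ∀ ev i t e → ev < K → i < L → All (WellFormed K) (edgeClauses ev i t e)
  edge-wellFormed ev i t e ev<K i<L with t <? L
  ... | no _ = []
  ... | yes t<L = wf₂ ev<K (reached<K t<L) ∷
                  Allₚ.++⁺ (assign-wellFormed ev _ _ _ ev<K (outAt<K i<L) (outAt<K t<L))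
                           (All-concatUpTo⁺ L _ λ j<L → assign-wellFormed ev _ _ _ ev<K (slot<K i<L j<L) (slot<K t<L j<L))

  SourceBelow : Source → Set
  SourceBelow (var v) = v < K
  SourceBelow (const _) = ⊤
  SourceBelow blocked = ⊤

  sourceOf-below : ∀ i a → i < L → SourceBelow (sourceOf i a)
  sourceOf-below i (inGet q) i<L with q <? N
  ... | yes q<N = input<K q<N
  ... | no _ = _
  sourceOf-below i (auxGet k) i<L = slot<K i<L i<L
  sourceOf-below i (auxSet k b) i<L = _
  sourceOf-below i (outSet b) i<L = _

  entry-wellFormed : ∀ i src → i < L → SourceBelow src → All (WellFormed K) (entryClauses i src)
  entry-wellFormed i (var v) i<L v<K = wf₃ (reached<K i<L) v<K (took<K true i<L) ∷ wf₃ (reached<K i<L) v<K (took<K false i<L) ∷ []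
  entry-wellFormed i (const b) i<L _ = wf₂ (reached<K i<L) (took<K b i<L) ∷ []
  entry-wellFormed i blocked i<L _ = []

  transition-wellFormed : ∀ i src skip e → i < L → SourceBelow src → All (WellFormed K) (transitionClauses i src skip e)
  transition-wellFormed i src skip e i<L src<K =
    Allₚ.++⁺ (entry-wellFormed i src i<L src<K)
             (Allₚ.++⁺ (edge-wellFormed _ i _ e (took<K true i<L) i<L) (edge-wellFormed _ i _ e (took<K false i<L) i<L))

  instr-wellFormed : ∀ i u → i < L → All (WellFormed K) (instrClauses i u)
  instr-wellFormed i u i<L with instrView u
  ... | basic κ a = subst (All (WellFormed K)) (sym (instrClauses-withKind i κ a))
                      (transition-wellFormed i (sourceOf i a) (skipped κ) (effectOf a) i<L (sourceOf-below i a i<L))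
  ... | jump zero = []
  ... | jump (suc l) = transition-wellFormed i (const true) (λ _ → l) noEffect i<L _
  ... | halt = wf₂ (reached<K i<L) (outAt<K i<L) ∷ []

  encoding-wellFormed : 0 < L → All (WellFormed K) encoding
  encoding-wellFormed 0<L =
    Allₚ.++⁺ (wf₁ (reached<K 0<L) ∷ wf₁ (outAt<K 0<L) ∷ All-concatUpTo⁺ L _ (λ j<L → wf₁ (slot<K 0<L j<L) ∷ []))
             (All-programClauses⁺ λ i {u} d → instr-wellFormed i u (drop-∷⇒< Xl i d))

-- The reduction

data Selector : Set where
  always never : Selector
  literal : ℕ → Bool → Selector

⟦_⟧ˢ : ∀ {n} → Selector → BoolFun n
⟦ always ⟧ˢ w = true
⟦ never ⟧ˢ w = false
⟦ literal q b ⟧ˢ w = agree (lookupℕ w q) b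

SelectorBelow : ℕ → Selector → Set
SelectorBelow n (literal q _) = q < n
SelectorBelow n _ = ⊤

selectorProgram : Selector → InstrSeq
selectorProgram always = plain (outSet true) ∷ halt ∷ []
selectorProgram never = halt ∷ []
selectorProgram (literal q b) = withKind (testKind b) (inGet q) ∷ plain (outSet true) ∷ halt ∷ []

selectorProgram-length : ∀ c → len (selectorProgram c) ≤ 3
selectorProgram-length always = s≤s (s≤s z≤n)
selectorProgram-length never = s≤s z≤n
selectorProgram-length (literal q b) = ≤-refl

selectorProgram-computes : ∀ {n} c → SelectorBelow n c → Computes {n} (selectorProgram c) ⟦ c ⟧ˢ
selectorProgram-computes always _ w = refl
selectorProgram-computes never _ w = refl
selectorProgram-computes (literal q b) q<n w
  rewrite exec-inGet w (testKind b) q (plain (outSet true) ∷ halt ∷ []) initState q<n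
        | skipped-testKind (lookupℕ w q) b
  with agree (lookupℕ w q) b
... | true = refl
... | false = refl

_≟ᴸ_ : ∀ {K} (A B : LitSet K) → Dec (A ≡ B)
_≟ᴸ_ = Product.≡-dec (Vec.≡-dec Bool._≟_) (Vec.≡-dec Bool._≟_)

-- Clause j of 3SATC is selected if it is a clause of the encoding, or a unit clause fixing one of the
-- first n inputs (the instance w) to its value; the remaining inputs stay free (the certificate).
module Selection (α : (k : ℕ) → Fin (nd k) → LitSet k) (n N : ℕ) (n≤N : n ≤ N) (Xl : List Instr) where

  open Encoding N Xl

  InEncoding : LitSet K → Set
  InEncoding C = Any (λ D → C ≡ toLitSet K D) encoding

  unitK : ℕ → Bool → LitSet K
  unitK q b = toLitSet K ((q , b) ∷ [])

  data SelectorFor (C : LitSet K) : Selector → Set where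
    encoded : InEncoding C → SelectorFor C always
    fixes   : ∀ (q : Fin n) b → ¬ InEncoding C → C ≡ unitK (toℕ q) b → SelectorFor C (literal (toℕ q) b)
    ignored : ¬ InEncoding C → (∀ (q : Fin n) b → ¬ C ≡ unitK (toℕ q) b) → SelectorFor C never

  selectorFor : (C : LitSet K) → ∃ (SelectorFor C)
  selectorFor C with Any.any? (λ D → C ≟ᴸ toLitSet K D) encoding
  ... | yes enc = always , encoded enc
  ... | no ¬enc with Fin.any? (λ q → C ≟ᴸ unitK (toℕ q) true) | Fin.any? (λ q → C ≟ᴸ unitK (toℕ q) false)
  ...   | yes (q , C≡) | _ = literal (toℕ q) true , fixes q true ¬enc C≡
  ...   | no _ | yes (q , C≡) = literal (toℕ q) false , fixes q false ¬enc C≡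
  ...   | no ¬pos | no ¬neg = never , ignored ¬enc unit
    where
    unit : ∀ q b → ¬ C ≡ unitK (toℕ q) b
    unit q true C≡ = ¬pos (q , C≡)
    unit q false C≡ = ¬neg (q , C≡)

  selector : Fin (nd K) → Selector
  selector j = proj₁ (selectorFor (α K j))

  selector-below : ∀ j → SelectorBelow n (selector j)
  selector-below j with selectorFor (α K j)
  ... | _ , encoded _ = _
  ... | _ , fixes q _ _ _ = toℕ<n q
  ... | _ , ignored _ _ = _

  module Correctness (surjective : ∀ L → 1 ≤ size L → size L ≤ 3 → ∃[ j ] α K j ≡ L)
                     (wellFormed : All (WellFormed K) encoding) where

    input<K : ∀ {q} → q < n → q < K
    input<K q<n = ≤-trans q<n (≤-trans n≤N (m≤m+n N _))

    index : ∀ C → WellFormed K C → ∃[ j ] α K j ≡ toLitSet K C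
    index C (C<K , 1≤|C| , |C|≤3) = surjective _ (1≤size-toLitSet K C C<K 1≤|C|) (≤-trans (size-toLitSet≤length K C) |C|≤3)

    unit-wellFormed : ∀ {q} b → q < n → WellFormed K ((q , b) ∷ [])
    unit-wellFormed b q<n = (input<K q<n ∷ []) , s≤s z≤n , s≤s z≤n

    module _ (w : Vec Bool n) where

      selection : Fin (nd K) → Bool
      selection j = ⟦ selector j ⟧ˢ w

      Extends : (ℕ → Bool) → Set
      Extends σ = CNFTrue σ encoding × (∀ q → q < n → σ q ≡ lookupℕ w q)

      encoded-selected : ∀ j → InEncoding (α K j) → selection j ≡ true
      encoded-selected j enc with selectorFor (α K j)
      ... | _ , encoded _ = refl
      ... | _ , fixes _ _ ¬enc _ = contradiction enc ¬enc
      ... | _ , ignored ¬enc _ = contradiction enc ¬enc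

      unit-selected : ∀ j q → q < n → α K j ≡ unitK q (lookupℕ w q) → selection j ≡ true
      unit-selected j q q<n αj≡ with selectorFor (α K j)
      ... | _ , encoded _ = refl
      ... | _ , fixes q' b _ αj≡'
        with unitLitSet-injective K (toℕ q') b q (lookupℕ w q) (input<K (toℕ<n q')) (input<K q<n) (trans (sym αj≡') αj≡)
      ...   | refl , refl = agree-refl b
      unit-selected j q q<n αj≡ | _ , ignored _ ¬unit =
        contradiction (subst (λ v → α K j ≡ unitK v (lookupℕ w q)) (sym (toℕ-fromℕ< q<n)) αj≡) (¬unit (fromℕ< q<n) (lookupℕ w q))

      satisfiable⇒extends : Satisfiable α K selection → ∃ Extends
      satisfiable⇒extends (a , sat) = lookupℕ a , All.tabulate clause-true , input-true
        where
        clause-true : ∀ {D} → Any (D ≡_) encoding → ClauseTrue (lookupℕ a) D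
        clause-true {D} D∈ with index D (All.lookup wellFormed D∈)
        ... | j , αj≡ = SatClause-toLitSet⁻ a D (subst (SatClause a) αj≡
                          (sat j (encoded-selected j (subst InEncoding (sym αj≡) (Any.map (cong (toLitSet K)) D∈)))))
        input-true : ∀ q → q < n → lookupℕ a q ≡ lookupℕ w q
        input-true q q<n with index ((q , lookupℕ w q) ∷ []) (unit-wellFormed (lookupℕ w q) q<n)
        ... | j , αj≡ with SatClause-toLitSet⁻ a ((q , lookupℕ w q) ∷ []) (subst (SatClause a) αj≡ (sat j (unit-selected j q q<n αj≡)))
        ...   | here aq≡ = aq≡

      extends⇒satisfiable : ∀ {σ} → Extends σ → Satisfiable α K selection
      extends⇒satisfiable {σ} (σ-encoding , σ-inputs) = a , λ j selected → sat (α K j) (proj₂ (selectorFor (α K j))) selected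
        where
        a : Vec Bool K
        a = tabulate (λ v → σ (toℕ v))
        σ≡a : ∀ v → v < K → σ v ≡ lookupℕ a v
        σ≡a v v<K = sym (lookupℕ-tabulate σ v v<K)
        sat : ∀ C {c} → SelectorFor C c → ⟦ c ⟧ˢ w ≡ true → SatClause a C
        sat C (encoded enc) _ with All.lookupAny (All.zip (wellFormed , σ-encoding)) enc
        ... | ((D<K , _) , σD) , C≡ = subst (SatClause a) (sym C≡) (SatClause-toLitSet⁺ a _ D<K (ClauseTrue-cong _ D<K σ≡a σD))
        sat C (fixes q b _ C≡) agrees =
          subst (SatClause a) (sym C≡) (SatClause-toLitSet⁺ a _ (input<K (toℕ<n q) ∷ [])
            (here (trans (sym (σ≡a _ (input<K (toℕ<n q)))) (trans (σ-inputs _ (toℕ<n q)) (agree-≡ _ b agrees)))))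
        sat C (ignored _ _) ()

⇔-true⇒≡ : ∀ {a b : Bool} → (a ≡ true ⇔ b ≡ true) → a ≡ b
⇔-true⇒≡ {true} a⇔b = sym (Equivalence.to a⇔b refl)
⇔-true⇒≡ {false} {true} a⇔b = Equivalence.from a⇔b refl
⇔-true⇒≡ {false} {false} _ = refl

length-toList : ∀ (X : InstrSeq) → length (toList X) ≡ len X
length-toList (_ ∷ _) = refl

0<length-toList : ∀ (X : InstrSeq) → 0 < length (toList X)
0<length-toList (_ ∷ _) = z<s

Satisfiable-cong : ∀ {α k} {s s' : Fin (nd k) → Bool} → (∀ i → s i ≡ s' i) → Satisfiable α k s → Satisfiable α k s'
Satisfiable-cong s≡s' (a , sat) = a , λ i selected → sat i (trans (s≡s' i) selected)

module Hardness (α : (k : ℕ) → Fin (nd k) → LitSet k) (valid : ValidEnumeration α)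
                (F : BoolFamily) (F-3SATC : Is3SATC α F) where

  surjective : ∀ k L → 1 ≤ size L → size L ≤ 3 → ∃[ j ] α k j ≡ L
  surjective = proj₁ (proj₂ (proj₂ valid))

  module Instance (g : BoolFamily) (h : Poly) (verifier : BoolFamily) (n : ℕ)
                  (g⇔ : ∀ w → (g n w ≡ true) ⇔ (Σ (Vec Bool (⟦ h ⟧ n)) λ c → verifier (n + ⟦ h ⟧ n) (w ++ᵛ c) ≡ true))
                  (X : InstrSeq) (computes : Computes X (verifier (n + ⟦ h ⟧ n))) where
    N : ℕ
    N = n + ⟦ h ⟧ n
    Xl : List Instr
    Xl = toList X
    open Encoding N Xl using (K)
    open Selection α n N (m≤m+n n _) Xl

    wellFormed : All (WellFormed K) (Encoding.encoding N Xl)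
    wellFormed = WellFormedness.encoding-wellFormed N Xl (0<length-toList X)
    open Correctness (surjective K) wellFormed

    accepting⇔extends : ∀ w → (Σ (Vec Bool (⟦ h ⟧ n)) λ c → verifier N (w ++ᵛ c) ≡ true) ⇔ ∃ (Extends w)
    accepting⇔extends w = mk⇔
      (λ (c , accepts) → let open Completeness N Xl (w ++ᵛ c) (0<length-toList X) (trans (computes (w ++ᵛ c)) (cong terminated accepts))
                         in σ , completeness , λ q q<n → trans (σ-inputs q (≤-trans q<n (m≤m+n n _))) (lookupℕ-++ˡ w c q q<n))
      (λ (σ , σ-encoding , σ-inputs) → let c = tabulate (λ y → σ (n + toℕ y)) in
         c , Soundness.soundness N Xl σ (w ++ᵛ c) σ-encoding (agrees-++ w σ σ-inputs) _ (computes (w ++ᵛ c)))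

    satisfiable⇔extends : ∀ w → Satisfiable α K (selection w) ⇔ ∃ (Extends w)
    satisfiable⇔extends w = mk⇔ (satisfiable⇒extends w) (λ (_ , extends) → extends⇒satisfiable w extends)

    F⇔satisfiable : ∀ w → (F (nd K) (tabulate (selection w)) ≡ true) ⇔ Satisfiable α K (selection w)
    F⇔satisfiable w = mk⇔ (Satisfiable-cong {α} selected≡ ∘ Equivalence.to F⇔) (Equivalence.from F⇔ ∘ Satisfiable-cong {α} (sym ∘ selected≡))
      where
      F⇔ : (F (nd K) (tabulate (selection w)) ≡ true) ⇔ Satisfiable α K (λ i → lookup (tabulate (selection w)) (inject≤ i ≤-refl))
      F⇔ = F-3SATC K (nd K) ≤-refl (nd-< K) (tabulate (selection w))
      selected≡ : ∀ i → lookup (tabulate (selection w)) (inject≤ i ≤-refl) ≡ selection w i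
      selected≡ i = trans (lookup∘tabulate (selection w) _) (cong (selection w) (inject≤-refl i ≤-refl))

    reduces : Reduces 3 (g n) (F (nd K))
    reduces = (λ j → ⟦ selector j ⟧ˢ) ,
              (λ j → selectorProgram (selector j) , selectorProgram-length (selector j) , selectorProgram-computes (selector j) (selector-below j)) ,
              (λ w → ⇔-true⇒≡ (begin
                g n w ≡ true                                          ≈⟨ g⇔ w ⟩
                (Σ (Vec Bool (⟦ h ⟧ n)) λ c → verifier N (w ++ᵛ c) ≡ true) ≈⟨ accepting⇔extends w ⟩
                ∃ (Extends w)                                         ≈⟨ satisfiable⇔extends w ⟨
                Satisfiable α K (selection w)                         ≈⟨ F⇔satisfiable w ⟨
                F (nd K) (tabulate (selection w)) ≡ true              ∎))
      where open import Relation.Binary.Reasoning.Setoid (⇔-setoid 0ℓ)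

  3SATC-hard : ∀ g → NP-IS g → PolyReducible g F
  3SATC-hard g (h , _ , verifier , (p , programs) , g⇔) =
    H , λ n → 3 , nd (K n) , ≤-trans (m≤m+n 3 _) (bound≤H n) , ≤-trans (≤-trans (nd-mono (K≤ n)) (m≤n+m _ 3)) (bound≤H n) ,
              Instance.reduces g h verifier n (g⇔ n) (proj₁ (programs (N n))) (proj₂ (proj₂ (programs (N n))))
    where
    N P Kmax bound : ℕ → ℕ
    N n = n + ⟦ h ⟧ n
    P n = ⟦ p ⟧ (N n)
    Kmax n = N n + P n * (4 + P n)
    bound n = 3 + nd (Kmax n)
    K : ℕ → ℕ
    K n = Encoding.K (N n) (toList (proj₁ (programs (N n))))
    K≤ : ∀ n → K n ≤ Kmax n
    K≤ n = +-monoʳ-≤ (N n) (*-mono-≤ L≤P (+-monoʳ-≤ 4 L≤P))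
      where
      L≤P : length (toList (proj₁ (programs (N n)))) ≤ P n
      L≤P = ≤-trans (≤-reflexive (length-toList (proj₁ (programs (N n))))) (proj₁ (proj₂ (programs (N n))))
    polyBounded-N : PolyBounded N
    polyBounded-N = polyBounded-+ polyBounded-id (polyBounded-⟦⟧ h)
    polyBounded-P : PolyBounded P
    polyBounded-P = polyBounded-∘ (polyBounded-⟦⟧ p) polyBounded-N
    polyBounded-bound : PolyBounded bound
    polyBounded-bound = polyBounded-+ (polyBounded-const 3) (polyBounded-∘ polyBounded-nd
      (polyBounded-+ polyBounded-N (polyBounded-* polyBounded-P (polyBounded-+ (polyBounded-const 4) polyBounded-P))))
    H : Poly
    H = proj₁ (polyBounded⇒poly polyBounded-bound)
    bound≤H : ∀ n → bound n ≤ ⟦ H ⟧ n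
    bound≤H = proj₂ (polyBounded⇒poly polyBounded-bound)

theorem14 : (α : (k : ℕ) → Fin (nd k) → LitSet k) → ValidEnumeration α →
            (F : BoolFamily) → Is3SATC α F → NP-IS-complete F
theorem14 α valid F F-3SATC = Membership.3SATC∈NP-IS α F F-3SATC , Hardness.3SATC-hard α valid F F-3SATC
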